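{- Let $z\in\mathfrak F_\infty$ and let $w^1w^2\cdots w^m\in\mathrm{RF}^m_{\mathsf{FPF}}(z)$ be an increasing factorization of $w\in\hat{\mathcal R}_{\mathsf{FPF}}(z)$. The odd operator $\tilde f^F_{\bar1}=(\mathrm H'_{\mathsf{Sp}})^{ -1}\circ(\mathrm{id},\tilde f^P_{\bar1})\circ\mathrm H'_{\mathsf{Sp}}$ acts as follows; whenever $\tilde f^F_{\bar1}(w^1\cdots w^m)\ne\mathbf 0$ it changes only the first two factors, producing $\tilde w^1\tilde w^2w^3\cdots w^m$. Suppose $|w^2|\ne 0$. (1) If $|w^1|=0$, then $\tilde f^F_{\bar1}(w^1\cdots w^m)=\mathbf0$. (2) If $|w^1|=1$, write $w^1=u_1$. If $u_1<\min\mathrm{cont}(w^2)$ then $\tilde w^1=()$ and $\mathrm{cont}(\tilde w^2)=\mathrm{cont}(w^2)\cup\{u_1\}$; otherwise $\tilde f^F_{\bar1}(w^1\cdots w^m)=\mathbf0$. (3) If $|w^1|\ge2$, write $w^1=u_1u_2\cdots$. If $u_2>u_1+1$ and $u_1<\min\mathrm{cont}(w^2)$, then $\mathrm{cont}(\tilde w^1)=\mathrm{cont}(w^1)\setminus\{u_1\}$ and $\mathrm{cont}(\tilde w^2)=\mathrm{cont}(w^2)\cup\{u_1\}$. If $u_2=u_1+1$ and $u_1<\min\mathrm{cont}(w^2)$, then $\mathrm{cont}(\tilde w^1)=\mathrm{cont}(w^1)\setminus\{u_1+1\}$ and $\mathrm{cont}(\tilde w^2)=\mathrm{cont}(w^2)\cup\{u_1-1\}$.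 Otherwise $\tilde f^F_{\bar1}(w^1\cdots w^m)=\mathbf0$. If $|w^2|=0$, the same description holds with the condition $u_1<\min\mathrm{cont}(w^2)$ dropped.
   Context: Let $s_i$ be the simple transposition $(i\ i{+}1)$, $\mathfrak S_\infty$ the finitely supported permutations of $\{1,2,\dots\}$, $\Theta=(1\,2)(3\,4)\cdots$, $\mathfrak F_\infty=\{\pi^{ -1}\Theta\pi:\pi\in\mathfrak S_\infty\}$. For $z\in\mathfrak F_\infty$, $\hat{\mathcal R}_{\mathsf{FPF}}(z)$ is the set of FPF-involution words for $z$: words $i_1\cdots i_l$ of positive integers with $z=s_{i_l}\cdots s_{i_1}\Theta s_{i_1}\cdots s_{i_l}$ and $l$ minimal. An increasing factorization with $m$ blocks of $w$ is a sequence $w^1\cdots w^m$ of strictly increasing (possibly empty) words concatenating to $w$; $\mathrm{RF}^m_{\mathsf{FPF}}(z)$ is the set of these for all $w\in\hat{\mathcal R}_{\mathsf{FPF}}(z)$. $\mathrm{cont}(u)$ is the set of letters of $u$, and a strictly increasing word is determined by its content. Shifted diagram of strict $\lambda$: $S(\lambda)=\{(i,j):1\le i\le\ell(\lambda),\ i\le j\le\lambda_i+i-1\}$ (rows, columns, main diagonal $(i,i)$). An increasing shifted tableau: filling of $S(\lambda)$ by positive integers strictly increasing along rows and down columns; $T_{(i,j)}$ is the entry at $(i,j)$. A primed tableau with entries $\le m$: filling of $S(\lambda)$ by letters from $1'<1<2'<2<\cdots<m'<m$, weakly increasing along rows and columns, with at most one $i'$ in each row, at most one unprimed $i$ in each column,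 and no primed letters on the main diagonal. FPF-involution Coxeter–Knuth insertion: to insert letter $a$ into increasing shifted tableau $T$, insert $a$ into the first row, where inserting $x$ into a row or column $L$ means: let $b$ be the smallest entry of $L$ with $x\le b$; if none, append $x$ at the end of $L$ and stop; otherwise (1) if $x=b$, leave $L$ unchanged and insert $x+1$ into the row below (if $L$ is a row) or the next column to the right (if $L$ is a column); (2) if $L$ is a row, $b$ is its first entry and $x\not\equiv b\pmod2$, leave $L$ unchanged and insert $x+2$ into the next column to the right; (3) otherwise replace $b$ by $x$ and insert $b$ into the row below if $L$ is a row, or into the next column to the right if $L$ is a column or $b$ was on the main diagonal. For $w=u_1\cdots u_l$, insert $u_1,\dots,u_l$ successively into the empty tableau; $P_{\mathsf{Sp}}(w)$ is the final tableau, and $Q_{\mathsf{Sp}}(w)$ records, for each $k$, a box at the position where the insertion of $u_k$ terminated, with entry $k$ if it terminated with a row insertion and $k'$ if with a column insertion. For an increasing factorization $w^1\cdots w^m$ of $w$, $Q_{\mathsf{Sp}}(w^1\cdots w^m)$ is obtained from $Q_{\mathsf{Sp}}(w)$ by replacing each entry created while inserting a letter of $w^i$ by $i$ if it is unprimed and by $i'$ if primed. The map $\mathrm H'_{\mathsf{Sp}}:w^1\cdots w^m\mapsto(P_{\mathsf{Sp}}(w),Q_{\mathsf{Sp}}(w^1\cdots w^m))$ is (by a theorem of Marberg) a bijection from $\mathrm{RF}^m_{\mathsf{FPF}}(z)$ onto pairs $(P,Q)$ with $P$ increasing shifted, $\mathfrak{row}(P)\in\hat{\mathcal R}_{\mathsf{FPF}}(z)$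 (row reading word: rows read left to right, from the last row to the first), and $Q$ a primed tableau with entries $\le m$ of the same shape. The operator $\tilde f^P_{\bar1}$ on primed tableaux $Q$: if the first row of $Q$ contains no letter $1$, $\tilde f^P_{\bar1}Q=\mathbf0$. Otherwise let $(1,i)$ be the position of the rightmost $1$ in the first row. If $i=1$: if $Q_{(1,2)}=2'$ then $\mathbf0$, else change $Q_{(1,1)}=1$ to $2$. If $i\ge2$: if $Q_{(1,i+1)}=2'$ then $\mathbf0$, else change $Q_{(1,i)}=1$ to $2'$. The composite $(\mathrm{H}'_{\mathsf{Sp}})^{ -1}\circ(\mathrm{id},\tilde f^P_{\bar1})\circ\mathrm H'_{\mathsf{Sp}}$ is $\mathbf0$ when $\tilde f^P_{\bar1}Q=\mathbf0$. -}

module Defs where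

open import Data.Nat using (ℕ; zero; suc; _+_; _*_; _∸_; _≤_; _<_; _≡ᵇ_; _≤ᵇ_; _%_)
open import Data.Bool using (Bool; true; false; if_then_else_; _∧_; not)
open import Data.List using (List; []; _∷_; [_]; _++_; length; map; concat)
open import Data.Nat.ListAction using (sum)
open import Data.List.Relation.Unary.All using (All)
open import Data.List.Relation.Unary.Linked using (Linked)
open import Data.List.Membership.Propositional using (_∈_)
open import Data.Maybe using (Maybe; just; nothing)
open import Data.Product using (_×_; _,_; proj₁; proj₂; ∃)
open import Relation.Binary.PropositionalEquality using (_≡_)
open import Function using (_∘_)

-- Permutations of {1,2,...}, encoded as maps ℕ → ℕ fixing 0.

s : ℕ → ℕ → ℕ
s i n = if n ≡ᵇ i then suc i else (if n ≡ᵇ suc i then i else n)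

-- Θ = (1 2)(3 4)⋯  (and Θ 0 = 0)
Θ : ℕ → ℕ
Θ zero = zero
Θ (suc zero) = 2
Θ (suc (suc zero)) = 1
Θ (suc (suc (suc n))) = 2 + Θ (suc n)

_≗_ : (ℕ → ℕ) → (ℕ → ℕ) → Set
f ≗ g = ∀ n → f n ≡ g n

record FinPerm : Set where
  field
    π      : ℕ → ℕ
    πinv   : ℕ → ℕ
    left   : ∀ n → πinv (π n) ≡ n
    right  : ∀ n → π (πinv n) ≡ n
    fix0   : π 0 ≡ 0
    finSupp : ∃ λ N → ∀ n → N ≤ n → π n ≡ n

InF∞ : (ℕ → ℕ) → Set
InF∞ z = ∃ λ (p : FinPerm) → z ≗ (FinPerm.πinv p ∘ Θ ∘ FinPerm.π p)

-- conjugation: for w = i₁⋯i_l,  act w = s_{i_l}⋯s_{i₁} Θ s_{i₁}⋯s_{i_l}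
conjAct : (ℕ → ℕ) → List ℕ → (ℕ → ℕ)
conjAct f [] = f
conjAct f (a ∷ w) = conjAct (s a ∘ f ∘ s a) w

act : List ℕ → (ℕ → ℕ)
act = conjAct Θ

Positive : List ℕ → Set
Positive = All (1 ≤_)

IsFPFWord : (ℕ → ℕ) → List ℕ → Set
IsFPFWord z w =
  Positive w × (act w ≗ z) ×
  (∀ (w' : List ℕ) → Positive w' → act w' ≗ z → length w ≤ length w')

StrictInc : List ℕ → Set
StrictInc = Linked _<_

IsRF : (ℕ → ℕ) → List (List ℕ) → Set
IsRF z bs = All StrictInc bs × IsFPFWord z (concat bs)

-- Shifted tableaux: list of rows; row i (0-based) occupies columns
-- i, i+1, …, i + length(row i) − 1 (0-based coordinates).

Tab : Set → Set
Tab A = List (List A)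

lookupL : {A : Set} → List A → ℕ → Maybe A
lookupL [] _ = nothing
lookupL (x ∷ xs) zero = just x
lookupL (x ∷ xs) (suc n) = lookupL xs n

updateL : {A : Set} → List A → ℕ → A → List A
updateL [] _ _ = []
updateL (x ∷ xs) zero a = a ∷ xs
updateL (x ∷ xs) (suc n) a = x ∷ updateL xs n a

rowAt : {A : Set} → Tab A → ℕ → List A
rowAt [] _ = []
rowAt (r ∷ rs) zero = r
rowAt (r ∷ rs) (suc n) = rowAt rs n

updateRow : {A : Set} → Tab A → ℕ → (List A → List A) → Tab A
updateRow [] _ _ = []
updateRow (r ∷ rs) zero f = f r ∷ rs
updateRow (r ∷ rs) (suc n) f = r ∷ updateRow rs n f

appendAt : {A : Set} → Tab A → ℕ → A → Tab A
appendAt [] zero a = [ a ] ∷ []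
appendAt [] (suc r) a = [] ∷ appendAt [] r a
appendAt (row ∷ rs) zero a = (row ++ [ a ]) ∷ rs
appendAt (row ∷ rs) (suc r) a = row ∷ appendAt rs r a

indexed : {A : Set} → ℕ → List A → List (ℕ × A)
indexed i [] = []
indexed i (x ∷ xs) = (i , x) ∷ indexed (suc i) xs

colGo : ℕ → ℕ → Tab ℕ → List (ℕ × ℕ)
colGo c i [] = []
colGo c i (row ∷ rs) with i ≤ᵇ c | lookupL row (c ∸ i)
... | true | just v = (i , v) ∷ colGo c (suc i) rs
... | _    | _      = colGo c (suc i) rs

colEntries : ℕ → Tab ℕ → List (ℕ × ℕ)
colEntries c T = colGo c 0 T

minGE : ℕ → List (ℕ × ℕ) → Maybe (ℕ × ℕ)
minGE x [] = nothing
minGE x ((p , v) ∷ rest) with minGE x rest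
... | nothing = if x ≤ᵇ v then just (p , v) else nothing
... | just (p' , v') =
  if x ≤ᵇ v then (if v ≤ᵇ v' then just (p , v) else just (p' , v'))
  else just (p' , v')

size : {A : Set} → Tab A → ℕ
size T = sum (map length T)

data Mode : Set where
  row : ℕ → Mode
  col : ℕ → Mode

-- returns (new tableau, row index of the new box, terminated by column insertion?)
-- The fuel argument is always sufficient (≤ #rows+1 row steps and
-- ≤ #columns+1 column steps); the zero-fuel clause is unreachable.
step : ℕ → Mode → ℕ → Tab ℕ → Tab ℕ × ℕ × Bool
step zero m x T = T , 0 , false
step (suc f) (row r) x T with minGE x (indexed 0 (rowAt T r))
... | nothing = appendAt T r x , r , false
... | just (j , b) =
  if x ≡ᵇ b then step f (row (suc r)) (suc x) T
  else (if (j ≡ᵇ 0) ∧ not (x % 2 ≡ᵇ b % 2)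
        then step f (col (suc r)) (x + 2) T
        else (if j ≡ᵇ 0
              then step f (col (suc r)) b (updateRow T r (λ L → updateL L j x))
              else step f (row (suc r)) b (updateRow T r (λ L → updateL L j x))))
step (suc f) (col c) x T with minGE x (colEntries c T)
... | nothing = appendAt T (length (colEntries c T)) x , length (colEntries c T) , true
... | just (i , b) =
  if x ≡ᵇ b then step f (col (suc c)) (suc x) T
  else step f (col (suc c)) b (updateRow T i (λ L → updateL L (c ∸ i) x))

insertSp : ℕ → Tab ℕ → Tab ℕ × ℕ × Bool
insertSp a T = step (3 * size T + 3) (row 0) a T

-- primed-tableau letters: (i , false) = i,  (i , true) = i'
Letter : Set
Letter = ℕ × Bool

pqGo : ℕ → List ℕ → Tab ℕ → Tab Letter → Tab ℕ × Tab Letter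
pqGo k [] P Q = P , Q
pqGo k (a ∷ w) P Q =
  pqGo (suc k) w (proj₁ (insertSp a P))
       (appendAt Q (proj₁ (proj₂ (insertSp a P))) (k , proj₂ (proj₂ (insertSp a P))))

P-Sp : List ℕ → Tab ℕ
P-Sp w = proj₁ (pqGo 1 w [] [])

Q-Sp : List ℕ → Tab Letter
Q-Sp w = proj₂ (pqGo 1 w [] [])

-- block (1-based) containing the k-th letter (1-based), given block lengths
blockOf : List ℕ → ℕ → ℕ
blockOf [] k = 1
blockOf (n ∷ ns) k = if k ≤ᵇ n then 1 else suc (blockOf ns (k ∸ n))

-- Q_Sp(w¹⋯wᵐ): relabel k ↦ i (resp. k' ↦ i') for letters of wⁱ
Q-SpF : List (List ℕ) → Tab Letter
Q-SpF bs = map (map (λ e → blockOf (map length bs) (proj₁ e) , proj₂ e)) (Q-Sp (concat bs))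

-- the operator f̃^P_{1̄} on primed tableaux (nothing = 𝟎)

rightmost1 : ℕ → List Letter → Maybe ℕ
rightmost1 i [] = nothing
rightmost1 i ((v , p) ∷ rest) with rightmost1 (suc i) rest
... | just j = just j
... | nothing = if (v ≡ᵇ 1) ∧ not p then just i else nothing

is2' : Maybe Letter → Bool
is2' (just (v , p)) = (v ≡ᵇ 2) ∧ p
is2' nothing = false

fP : Tab Letter → Maybe (Tab Letter)
fP [] = nothing
fP (r0 ∷ rs) with rightmost1 0 r0
... | nothing = nothing
... | just zero =
  if is2' (lookupL r0 1) then nothing else just (updateL r0 0 (2 , false) ∷ rs)
... | just (suc j) =
  if is2' (lookupL r0 (suc (suc j))) then nothing else just (updateL r0 (suc j) (2 , true) ∷ rs)

-- f̃^F_{1̄} = (H'_Sp)⁻¹ ∘ (id , f̃^P_{1̄}) ∘ H'_Sp, as a relation: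
-- f̃^F_{1̄}(bs) = cs  (cs ∈ RF(z) with H'_Sp(cs) = (P_Sp(bs), f̃^P_{1̄} Q_Sp(bs)))
-- and f̃^F_{1̄}(bs) = 𝟎 iff f̃^P_{1̄} Q_Sp(bs) = 𝟎.

FF : (ℕ → ℕ) → List (List ℕ) → List (List ℕ) → Set
FF z bs cs = IsRF z cs × P-Sp (concat cs) ≡ P-Sp (concat bs) × fP (Q-SpF bs) ≡ just (Q-SpF cs)

FFzero : List (List ℕ) → Set
FFzero bs = fP (Q-SpF bs) ≡ nothing

-- u < min cont(v) when v is nonempty; vacuous for empty v
LtMin : ℕ → List ℕ → Set
LtMin u v = All (u <_) v

module Submission where

-- As w¹ = u₁ u₂ ⋯ is strictly increasing, inserting it gives the one-row
-- tableau P = (w¹) and a first row 1 ⋯ 1 of Q, so f̃^P_{1̄} acts on the last 1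
-- and is 𝟎 exactly when the next entry of row 0 is 2′.  If w² starts below u₁
-- that entry is a 2′ (its first letter ends in a column insertion); if w² lies
-- above u₁ its letters never write a 2′ into row 0 (second-block-harmless).
-- In the nonzero cases we exhibit the new factorization: moving u₁ into w², or
-- (when u₂ = u₁+1) replacing u₁+1 in w¹ by u₁−1 in w²; inserting it passes
-- through the same P-tableau and yields exactly f̃^P_{1̄} Q.  That the new words
-- are reduced, and that w² cannot start with u₁, follows from Coxeter
-- relations for the conjugates of Θ: odd letters fix Θ (so reduced words start
-- with an even letter) and a braid identity holds at even letters; both are
-- finite checks at small letters, transported by translating by 2k.

open import Defs
open import Data.Nat using (ℕ; zero; suc; _+_; _*_; _∸_; _≤_; _<_; _≡ᵇ_; _≤ᵇ_; _<ᵇ_; _%_; z≤n; s≤s)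
open import Data.Nat.Properties using (≤-refl; ≤-trans; <-trans; n≤1+n; n<1+n; 1+n≢n; <⇒≢; ≤-<-trans; <-≤-trans; <-irrefl; _≟_; _≤?_; +-comm; +-suc; +-identityʳ; <⇒≤; ≰⇒>; ≤-pred; m≤m+n; m≤n+m; ≤∧≢⇒<; m≤n⇒∃[o]m+o≡n; m+n∸n≡m; <-cmp; m≤n⇒m<n∨m≡n)
open import Data.Bool using (true; false; if_then_else_; not)
open import Data.Bool.Properties using (∧-zeroʳ)
open import Data.List using (List; []; _∷_; [_]; _++_; length; map; replicate; concat; head)
open import Data.List.Properties using (length-++; ++-assoc; map-++; ++-identityʳ; length-map)
open import Data.List.Relation.Unary.All as All using (All; []; _∷_; tabulate)
import Data.List.Relation.Unary.All.Properties as AllP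
open import Data.List.Relation.Unary.Any using (here; there)
open import Data.List.Relation.Unary.Linked as Linked using ([]; [-]; _∷_)
open import Data.List.Relation.Unary.Linked.Properties using (Linked⇒All)
open import Data.List.Membership.Propositional using (_∈_)
open import Data.List.Membership.Propositional.Properties using (∈-++⁻; ∈-++⁺ʳ)
open import Data.Maybe as Maybe using (Maybe; just; nothing)
open import Data.Product using (_×_; _,_; proj₁; proj₂; ∃; ∃₂)
open import Data.Sum using (_⊎_; inj₁; inj₂; swap)
open import Data.Unit using (⊤; tt)
open import Data.Empty using (⊥; ⊥-elim)
open import Relation.Nullary using (¬_; yes; no)
open import Relation.Binary.Definitions using (tri<; tri≈; tri>)
open import Relation.Binary.PropositionalEquality using (_≡_; _≢_; refl; sym; trans; cong; cong₂; subst; ≢-sym; module ≡-Reasoning)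
open import Function using (_∘_)
open import Function.Bundles using (_⇔_; mk⇔)

open ≡-Reasoning

-- Boolean comparisons, in the "≡ true / ≡ false" form needed to rewrite the
-- tests performed by the insertion algorithm.

≡ᵇ-refl : ∀ n → (n ≡ᵇ n) ≡ true
≡ᵇ-refl zero = refl
≡ᵇ-refl (suc n) = ≡ᵇ-refl n

≢⇒≡ᵇ≡false : ∀ m n → m ≢ n → (m ≡ᵇ n) ≡ false
≢⇒≡ᵇ≡false zero zero m≢n = ⊥-elim (m≢n refl)
≢⇒≡ᵇ≡false zero (suc n) _ = refl
≢⇒≡ᵇ≡false (suc m) zero _ = refl
≢⇒≡ᵇ≡false (suc m) (suc n) m≢n = ≢⇒≡ᵇ≡false m n (m≢n ∘ cong suc)

<⇒<ᵇ≡true : ∀ {m n} → m < n → (m <ᵇ n) ≡ true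
<⇒<ᵇ≡true {zero} {suc n} _ = refl
<⇒<ᵇ≡true {suc m} {suc n} (s≤s m<n) = <⇒<ᵇ≡true m<n

≤⇒≤ᵇ≡true : ∀ {m n} → m ≤ n → (m ≤ᵇ n) ≡ true
≤⇒≤ᵇ≡true {zero} _ = refl
≤⇒≤ᵇ≡true {suc m} m<n = <⇒<ᵇ≡true m<n

≥⇒<ᵇ≡false : ∀ {m n} → n ≤ m → (m <ᵇ n) ≡ false
≥⇒<ᵇ≡false {m} {zero} _ = refl
≥⇒<ᵇ≡false {suc m} {suc n} (s≤s n≤m) = ≥⇒<ᵇ≡false n≤m

>⇒≤ᵇ≡false : ∀ {m n} → n < m → (m ≤ᵇ n) ≡ false
>⇒≤ᵇ≡false {suc m} (s≤s n≤m) = ≥⇒<ᵇ≡false n≤m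

s-left : ∀ a → s a a ≡ suc a
s-left a rewrite ≡ᵇ-refl a = refl

s-right : ∀ a → s a (suc a) ≡ a
s-right a rewrite ≢⇒≡ᵇ≡false (suc a) a 1+n≢n | ≡ᵇ-refl a = refl

s-fixes : ∀ a n → n ≢ a → n ≢ suc a → s a n ≡ n
s-fixes a n n≢a n≢1+a rewrite ≢⇒≡ᵇ≡false n a n≢a | ≢⇒≡ᵇ≡false n (suc a) n≢1+a = refl

s-involutive : ∀ a n → s a (s a n) ≡ n
s-involutive a n with n ≟ a
... | yes refl rewrite s-left n = s-right n
... | no n≢a with n ≟ suc a
...   | yes refl rewrite s-right a = s-left a
...   | no n≢1+a rewrite s-fixes a n n≢a n≢1+a = s-fixes a n n≢a n≢1+a

s-suc : ∀ a n → s (suc a) (suc n) ≡ suc (s a n)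
s-suc a n with n ≡ᵇ a
... | true = refl
... | false with n ≡ᵇ suc a
...   | true = refl
...   | false = refl

FarApart : ℕ → ℕ → Set
FarApart a b = suc a < b ⊎ suc b < a

s-comm-< : ∀ a b n → suc a < b → s a (s b n) ≡ s b (s a n)
s-comm-< a b n 1+a<b = commute n
  where
  1+a≢b : suc a ≢ b
  1+a≢b = <⇒≢ 1+a<b
  a≢b : a ≢ b
  a≢b = <⇒≢ (<-trans (n<1+n a) 1+a<b)
  1+a≢1+b : suc a ≢ suc b
  1+a≢1+b = <⇒≢ (<-trans 1+a<b (n<1+n b))
  a≢1+b : a ≢ suc b
  a≢1+b = <⇒≢ (<-trans (n<1+n a) (<-trans 1+a<b (n<1+n b)))
  commute : ∀ n → s a (s b n) ≡ s b (s a n)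
  commute n with n ≟ a
  ... | yes refl rewrite s-left n | s-fixes b n a≢b a≢1+b | s-left n | s-fixes b (suc n) 1+a≢b 1+a≢1+b = refl
  ... | no n≢a with n ≟ suc a
  ...   | yes refl rewrite s-right a | s-fixes b (suc a) 1+a≢b 1+a≢1+b | s-right a | s-fixes b a a≢b a≢1+b = refl
  ...   | no n≢1+a with n ≟ b
  ...     | yes refl rewrite s-fixes a n n≢a n≢1+a | s-left n
               | s-fixes a (suc n) (≢-sym a≢1+b) (≢-sym 1+a≢1+b) = refl
  ...     | no n≢b with n ≟ suc b
  ...       | yes refl rewrite s-fixes a (suc b) n≢a n≢1+a | s-right b | s-fixes a b (≢-sym a≢b) (≢-sym 1+a≢b) = refl
  ...       | no n≢1+b rewrite s-fixes a n n≢a n≢1+a | s-fixes b n n≢b n≢1+b | s-fixes a n n≢a n≢1+a = refl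

s-comm : ∀ a b n → FarApart a b → s a (s b n) ≡ s b (s a n)
s-comm a b n (inj₁ 1+a<b) = s-comm-< a b n 1+a<b
s-comm a b n (inj₂ 1+b<a) = sym (s-comm-< b a n 1+b<a)

conj : ℕ → (ℕ → ℕ) → (ℕ → ℕ)
conj a f = s a ∘ f ∘ s a

≗-trans : {f g h : ℕ → ℕ} → f ≗ g → g ≗ h → f ≗ h
≗-trans f≗g g≗h n = trans (f≗g n) (g≗h n)

≗-sym : {f g : ℕ → ℕ} → f ≗ g → g ≗ f
≗-sym f≗g n = sym (f≗g n)

conj-resp : ∀ a {f g} → f ≗ g → conj a f ≗ conj a g
conj-resp a f≗g n = cong (s a) (f≗g (s a n))

conjAct-resp : ∀ {f g} w → f ≗ g → conjAct f w ≗ conjAct g w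
conjAct-resp [] f≗g = f≗g
conjAct-resp (a ∷ w) f≗g = conjAct-resp w (conj-resp a f≗g)

conjAct-++ : ∀ f xs ys → conjAct f (xs ++ ys) ≡ conjAct (conjAct f xs) ys
conjAct-++ f [] ys = refl
conjAct-++ f (x ∷ xs) ys = conjAct-++ (conj x f) xs ys

conj-conj : ∀ a f → conj a (conj a f) ≗ f
conj-conj a f n rewrite s-involutive a n = s-involutive a _

conj-comm : ∀ a b f → FarApart a b → conj a (conj b f) ≗ conj b (conj a f)
conj-comm a b f far n =
  trans (cong (λ v → s a (s b (f v))) (s-comm b a n (swap far))) (s-comm a b (f (s a (s b n))) far)

conj-pass : ∀ a f t → All (FarApart a) t → conjAct (conj a f) t ≗ conj a (conjAct f t)
conj-pass a f [] [] n = refl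
conj-pass a f (b ∷ t) (far ∷ fars) =
  ≗-trans (conjAct-resp t (conj-comm b a f (swap far))) (conj-pass a (conj b f) t fars)

conjAct-move : ∀ f a t W → All (FarApart a) t → conjAct f (t ++ a ∷ W) ≗ conjAct f (a ∷ t ++ W)
conjAct-move f a t W fars rewrite conjAct-++ f t (a ∷ W) | conjAct-++ (conj a f) t W =
  conjAct-resp W (≗-sym (conj-pass a f t fars))

dbl : ℕ → ℕ
dbl zero = zero
dbl (suc k) = suc (suc (dbl k))

parity : ∀ n → (∃ λ k → n ≡ dbl k) ⊎ (∃ λ k → n ≡ suc (dbl k))
parity zero = inj₁ (0 , refl)
parity (suc n) with parity n
... | inj₁ (k , refl) = inj₂ (k , refl)
... | inj₂ (k , refl) = inj₁ (suc k , refl)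

dbl-even : ∀ k → dbl k % 2 ≡ 0
dbl-even zero = refl
dbl-even (suc k) = dbl-even k

dbl-odd : ∀ k → suc (dbl k) % 2 ≡ 1
dbl-odd zero = refl
dbl-odd (suc k) = dbl-odd k

Θ-positive : ∀ r → ∃ λ y → Θ (suc r) ≡ suc y
Θ-positive zero = 1 , refl
Θ-positive (suc zero) = 0 , refl
Θ-positive (suc (suc r)) with Θ-positive r
... | y , eq rewrite eq = suc (suc y) , refl

Θ-translate : ∀ k m → m ≢ 0 → Θ (m + dbl k) ≡ Θ m + dbl k
Θ-translate zero m _ rewrite +-identityʳ m = sym (+-identityʳ (Θ m))
Θ-translate (suc k) zero m≢0 = ⊥-elim (m≢0 refl)
Θ-translate (suc k) (suc m) _
  rewrite +-suc (suc m) (suc (dbl k)) | +-suc (suc m) (dbl k) | Θ-translate k (suc m) (λ ())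
        | +-suc (Θ (suc m)) (suc (dbl k)) | +-suc (Θ (suc m)) (dbl k) = refl

Θ-odd-value : ∀ k → Θ (suc (dbl k)) ≡ suc (suc (dbl k))
Θ-odd-value zero = refl
Θ-odd-value (suc k) = cong (λ v → suc (suc v)) (Θ-odd-value k)

Θ-even-value : ∀ k → Θ (suc (suc (dbl k))) ≡ suc (dbl k)
Θ-even-value zero = refl
Θ-even-value (suc k) = cong (λ v → suc (suc v)) (Θ-even-value k)

Θ-below : ∀ k n → n ≤ dbl k → Θ n ≤ dbl k
Θ-below zero zero _ = z≤n
Θ-below (suc k) n n≤2k+2 with n ≟ suc (dbl k) | n ≟ suc (suc (dbl k))
... | yes refl | _ rewrite Θ-odd-value k = ≤-refl
... | no _ | yes refl rewrite Θ-even-value k = n≤1+n _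
... | no n≢2k+1 | no n≢2k+2 = ≤-trans (Θ-below k n n≤2k) (≤-trans (n≤1+n _) (n≤1+n _))
  where
  n≤2k : n ≤ dbl k
  n≤2k = ≤-pred (≤∧≢⇒< (≤-pred (≤∧≢⇒< n≤2k+2 n≢2k+2)) n≢2k+1)

-- Translation principle.  f "translates g by 2k" if f agrees with Θ on
-- {0, …, 2k} and f (m + 2k) = g m + 2k for m ≥ 1.  Conjugating f by s (a + 2k)
-- and g by s a (a ≥ 1) preserves this, so every identity between Θ-conjugates
-- by small letters transfers to the letters translated by 2k.

Translates : ℕ → (ℕ → ℕ) → (ℕ → ℕ) → Set
Translates k f g = (∀ n → n ≤ dbl k → f n ≡ Θ n) × (∀ m → m ≢ 0 → f (m + dbl k) ≡ g m + dbl k)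

s-translate : ∀ a m d → s (a + d) (m + d) ≡ s a m + d
s-translate a m zero rewrite +-identityʳ a | +-identityʳ m = sym (+-identityʳ (s a m))
s-translate a m (suc d)
  rewrite +-suc a d | +-suc m d | s-suc (a + d) (m + d) | s-translate a m d = sym (+-suc (s a m) d)

s-below : ∀ b d n → n ≤ d → s (suc b + d) n ≡ n
s-below b d n n≤d = s-fixes (suc b + d) n (<⇒≢ n<a) (<⇒≢ (<-trans n<a (n<1+n _)))
  where
  n<a : n < suc b + d
  n<a = s≤s (≤-trans n≤d (m≤n+m d b))

s-nonzero : ∀ b m → m ≢ 0 → s (suc b) m ≢ 0
s-nonzero b zero m≢0 = ⊥-elim (m≢0 refl)
s-nonzero b (suc m) _ eq with () ← trans (sym (s-suc b m)) eq

Θ-translates : ∀ k → Translates k Θ Θ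
Θ-translates k = (λ n _ → refl) , Θ-translate k

conj-translates : ∀ k b {f g} → Translates k f g → Translates k (conj (suc b + dbl k) f) (conj (suc b) g)
conj-translates k b {f} {g} (low , high) = low′ , high′
  where
  low′ : ∀ n → n ≤ dbl k → conj (suc b + dbl k) f n ≡ Θ n
  low′ n n≤2k rewrite s-below b (dbl k) n n≤2k | low n n≤2k = s-below b (dbl k) (Θ n) (Θ-below k n n≤2k)
  high′ : ∀ m → m ≢ 0 → conj (suc b + dbl k) f (m + dbl k) ≡ conj (suc b) g m + dbl k
  high′ m m≢0 rewrite s-translate (suc b) m (dbl k) | high (s (suc b) m) (s-nonzero b m m≢0) =
    s-translate (suc b) (g (s (suc b) m)) (dbl k)

conjAct-translates : ∀ k w {f g} → Translates k f g →
  Translates k (conjAct f (map (λ b → suc b + dbl k) w)) (conjAct g (map suc w))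
conjAct-translates k [] t = t
conjAct-translates k (b ∷ w) t = conjAct-translates k w (conj-translates k b t)

above-or-below : ∀ d n → n ≤ d ⊎ ∃ λ m → n ≡ suc m + d
above-or-below d n with n ≤? d
... | yes n≤d = inj₁ n≤d
... | no n≰d with m≤n⇒∃[o]m+o≡n (≰⇒> n≰d)
...   | o , eq = inj₂ (o , trans (sym eq) (cong suc (+-comm d o)))

translated : ∀ k w → Translates k (conjAct Θ (map (λ b → suc b + dbl k) w)) (conjAct Θ (map suc w))
translated k w = conjAct-translates k w (Θ-translates k)

translate-≗ : ∀ k v w → conjAct Θ (map suc v) ≗ conjAct Θ (map suc w) →
  conjAct Θ (map (λ b → suc b + dbl k) v) ≗ conjAct Θ (map (λ b → suc b + dbl k) w)
translate-≗ k v w v≗w n with above-or-below (dbl k) n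
... | inj₁ n≤2k = trans (proj₁ (translated k v) n n≤2k) (sym (proj₁ (translated k w) n n≤2k))
... | inj₂ (m , refl) =
  trans (proj₂ (translated k v) (suc m) (λ ()))
    (trans (cong (_+ dbl k) (v≗w (suc m))) (sym (proj₂ (translated k w) (suc m) (λ ()))))

-- The three Coxeter identities at k = 0, checked on the first few values of n
-- (beyond them every transposition involved acts trivially).

Θ-conj-1 : conjAct Θ (1 ∷ []) ≗ Θ
Θ-conj-1 zero = refl
Θ-conj-1 (suc zero) = refl
Θ-conj-1 (suc (suc zero)) = refl
Θ-conj-1 (suc (suc (suc r))) with Θ-positive r
... | y , eq rewrite eq = refl

Θ-conj-23 : conjAct Θ (2 ∷ 3 ∷ []) ≗ conjAct Θ (2 ∷ 1 ∷ [])
Θ-conj-23 zero = refl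
Θ-conj-23 (suc zero) = refl
Θ-conj-23 (suc (suc zero)) = refl
Θ-conj-23 (suc (suc (suc zero))) = refl
Θ-conj-23 (suc (suc (suc (suc zero)))) = refl
Θ-conj-23 (suc (suc (suc (suc (suc r))))) with Θ-positive r
... | y , eq rewrite eq = refl

Θ-conj-232 : conjAct Θ (2 ∷ 3 ∷ 2 ∷ []) ≗ conjAct Θ (2 ∷ 3 ∷ [])
Θ-conj-232 zero = refl
Θ-conj-232 (suc zero) = refl
Θ-conj-232 (suc (suc zero)) = refl
Θ-conj-232 (suc (suc (suc zero))) = refl
Θ-conj-232 (suc (suc (suc (suc zero)))) = refl
Θ-conj-232 (suc (suc (suc (suc (suc r))))) with Θ-positive r
... | y , eq rewrite eq = refl

Θ-odd : ∀ k → conj (suc (dbl k)) Θ ≗ Θ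
Θ-odd k = translate-≗ k (0 ∷ []) [] Θ-conj-1

Θ-braid : ∀ k → let u = suc (suc (dbl k)) in
  conjAct Θ (u ∷ suc u ∷ []) ≗ conjAct Θ (u ∷ suc (dbl k) ∷ [])
Θ-braid k = translate-≗ k (1 ∷ 2 ∷ []) (1 ∷ 0 ∷ []) Θ-conj-23

Θ-braid-absorb : ∀ k → let u = suc (suc (dbl k)) in
  conjAct Θ (u ∷ suc u ∷ u ∷ []) ≗ conjAct Θ (u ∷ suc u ∷ [])
Θ-braid-absorb k = translate-≗ k (1 ∷ 2 ∷ 1 ∷ []) (1 ∷ 2 ∷ []) Θ-conj-232

reduced-minimal : ∀ {z w} → IsFPFWord z w → ∀ w′ → Positive w′ → act w′ ≗ act w → length w′ < length w → ⊥
reduced-minimal (_ , act≗z , minimal) w′ pos′ w′≗w shorter =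
  <-irrefl refl (<-≤-trans shorter (minimal w′ pos′ (≗-trans w′≗w act≗z)))

reduced-transfer : ∀ {z w} → IsFPFWord z w → ∀ w′ → Positive w′ → act w′ ≗ act w → length w′ ≡ length w →
  IsFPFWord z w′
reduced-transfer (_ , act≗z , minimal) w′ pos′ w′≗w same =
  pos′ , ≗-trans w′≗w act≗z , λ v pos-v v≗z → subst (_≤ length v) (sym same) (minimal v pos-v v≗z)

-- The first letter of a reduced word is even: an odd letter fixes Θ and
-- could be deleted.
first-letter-even : ∀ {z a W} → IsFPFWord z (a ∷ W) → ∃ λ k → a ≡ suc (suc (dbl k))
first-letter-even {a = a} red@(pos , _) with parity a
first-letter-even ((() ∷ _) , _) | inj₁ (zero , refl)
... | inj₁ (suc k , refl) = k , refl
first-letter-even {W = W} red@(_ ∷ pos , _) | inj₂ (k , refl) =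
  ⊥-elim (reduced-minimal red W pos (≗-sym (conjAct-resp W (Θ-odd k))) ≤-refl)

-- If the second letter b is far above the first letter a, it is even too:
-- an odd b could be commuted to the front and deleted.
second-letter-even : ∀ {z a b X} → IsFPFWord z (a ∷ b ∷ X) → suc a < b → ∃ λ k → b ≡ suc (suc (dbl k))
second-letter-even {b = b} red 1+a<b with parity b
... | inj₁ (zero , refl) = ⊥-elim (<⇒≢ (≤-trans (s≤s z≤n) 1+a<b) refl)
... | inj₁ (suc k , refl) = k , refl
second-letter-even {a = a} {X = X} red@(pos-a ∷ _ ∷ pos , _) 1+a<b | inj₂ (k , refl) =
  ⊥-elim (reduced-minimal red (a ∷ X) (pos-a ∷ pos)
    (≗-sym (conjAct-resp X (≗-trans (conj-comm (suc (dbl k)) a Θ (inj₂ 1+a<b)) (conj-resp a (Θ-odd k))))) ≤-refl)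

act-cancel-square : ∀ u X → act (u ∷ u ∷ X) ≗ act X
act-cancel-square u X = conjAct-resp X (conj-conj u Θ)

act-cancel-far : ∀ u t X → All (FarApart u) t → act (u ∷ t ++ u ∷ X) ≗ act (t ++ X)
act-cancel-far u t X fars = ≗-trans (conjAct-move (conj u Θ) u t X fars) (conjAct-resp (t ++ X) (conj-conj u Θ))

act-cancel-braid : ∀ k t X → let u = suc (suc (dbl k)) in All (FarApart u) t →
  act (u ∷ suc u ∷ t ++ u ∷ X) ≗ act (u ∷ suc u ∷ t ++ X)
act-cancel-braid k t X fars =
  ≗-trans (conjAct-move (conj (suc u) (conj u Θ)) u t X fars) (conjAct-resp (t ++ X) (Θ-braid-absorb k))
  where
  u : ℕ
  u = suc (suc (dbl k))

act-move-far : ∀ u t W → All (FarApart u) t → act (t ++ u ∷ W) ≗ act (u ∷ t ++ W)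
act-move-far u t W fars = conjAct-move Θ u t W fars

act-move-braid : ∀ k t W → let u = suc (suc (dbl k)) in All (FarApart (suc (dbl k))) t →
  act (u ∷ t ++ suc (dbl k) ∷ W) ≗ act (u ∷ suc u ∷ t ++ W)
act-move-braid k t W fars =
  ≗-trans (conjAct-move (conj u Θ) (suc (dbl k)) t W fars) (conjAct-resp (t ++ W) (≗-sym (Θ-braid k)))
  where
  u : ℕ
  u = suc (suc (dbl k))

head-below : ∀ {x xs} → StrictInc (x ∷ xs) → All (x <_) xs
head-below [-] = []
head-below (x<y ∷ ys) = Linked⇒All <-trans x<y ys

inc-tail : ∀ {x xs} → StrictInc (x ∷ xs) → StrictInc xs
inc-tail = Linked.tail

inc-drop : ∀ pre {ys} → StrictInc (pre ++ ys) → StrictInc ys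
inc-drop [] inc = inc
inc-drop (x ∷ pre) inc = inc-drop pre (inc-tail inc)

inc-replace : ∀ pre {b x suf} → StrictInc (pre ++ b ∷ suf) → All (_< x) pre → x ≤ b → StrictInc (pre ++ x ∷ suf)
inc-replace [] {suf = []} _ _ _ = [-]
inc-replace [] {suf = y ∷ suf} (b<y ∷ inc) _ x≤b = ≤-<-trans x≤b b<y ∷ inc
inc-replace (a ∷ []) (_ ∷ inc) (a<x ∷ _) x≤b = a<x ∷ inc-replace [] inc [] x≤b
inc-replace (a ∷ a′ ∷ pre) (a<a′ ∷ inc) (_ ∷ pre<x) x≤b = a<a′ ∷ inc-replace (a′ ∷ pre) inc pre<x x≤b

split-at : ∀ x R → All (_< x) R ⊎ ∃ λ pre → ∃₂ λ b suf → R ≡ pre ++ b ∷ suf × All (_< x) pre × x ≤ b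
split-at x [] = inj₁ []
split-at x (r ∷ R) with x ≤? r
... | yes x≤r = inj₂ ([] , r , R , refl , [] , x≤r)
... | no x≰r with split-at x R
...   | inj₁ R<x = inj₁ (≰⇒> x≰r ∷ R<x)
...   | inj₂ (pre , b , suf , refl , pre<x , x≤b) = inj₂ (r ∷ pre , b , suf , refl , ≰⇒> x≰r ∷ pre<x , x≤b)

length-snoc : ∀ {A : Set} (xs : List A) x → length (xs ++ [ x ]) ≡ suc (length xs)
length-snoc xs x = trans (length-++ xs) (+-comm (length xs) 1)

updateL-middle : ∀ {A : Set} (pre : List A) b x suf → updateL (pre ++ b ∷ suf) (length pre) x ≡ pre ++ x ∷ suf
updateL-middle [] b x suf = refl
updateL-middle (a ∷ pre) b x suf = cong (a ∷_) (updateL-middle pre b x suf)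

lookupL-middle : ∀ {A : Set} (pre suf : List A) → lookupL (pre ++ suf) (length pre) ≡ head suf
lookupL-middle [] [] = refl
lookupL-middle [] (x ∷ suf) = refl
lookupL-middle (a ∷ pre) suf = lookupL-middle pre suf

lookupL-column0 : ∀ {A : Set} (pre suf : List A) → lookupL (pre ++ suf) (length pre ∸ 0) ≡ head suf
lookupL-column0 = lookupL-middle

rowAt-appendAt : ∀ {A : Set} (S : Tab A) c → rowAt (appendAt S 0 c) 0 ≡ rowAt S 0 ++ [ c ]
rowAt-appendAt [] c = refl
rowAt-appendAt (r ∷ S) c = refl

All-indexed : ∀ {P : ℕ → Set} i R → All P R → All (P ∘ proj₂) (indexed i R)
All-indexed i [] [] = []
All-indexed i (r ∷ R) (p ∷ ps) = p ∷ All-indexed (suc i) R ps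

minGE-none : ∀ {x} i R → All (_< x) R → minGE x (indexed i R) ≡ nothing
minGE-none i [] [] = refl
minGE-none i (v ∷ R) (v<x ∷ R<x) rewrite minGE-none (suc i) R R<x | >⇒≤ᵇ≡false v<x = refl

minGE-member : ∀ {Q : ℕ × ℕ → Set} x L → All Q L → (minGE x L ≡ nothing) ⊎ (∃ λ pv → minGE x L ≡ just pv × Q pv)
minGE-member x [] [] = inj₁ refl
minGE-member x ((p , v) ∷ L) (q ∷ qs) with minGE x L | minGE-member x L qs
... | nothing | _ with x ≤ᵇ v
...   | true = inj₂ (_ , refl , q)
...   | false = inj₁ refl
minGE-member x ((p , v) ∷ L) (q ∷ qs) | just (p′ , v′) | inj₂ (_ , refl , q′) with x ≤ᵇ v
...   | false = inj₂ (_ , refl , q′)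
...   | true with v ≤ᵇ v′
...     | true = inj₂ (_ , refl , q)
...     | false = inj₂ (_ , refl , q′)

minGE-hit : ∀ {x b} i pre suf → All (_< x) pre → x ≤ b → All (b <_) suf →
  minGE x (indexed i (pre ++ b ∷ suf)) ≡ just (i + length pre , b)
minGE-hit {x} {b} i [] suf _ x≤b b<suf
  with minGE x (indexed (suc i) suf) | minGE-member {Q = (b <_) ∘ proj₂} x (indexed (suc i) suf) (All-indexed (suc i) suf b<suf)
... | nothing | _ rewrite ≤⇒≤ᵇ≡true x≤b | +-identityʳ i = refl
... | just _ | inj₂ (_ , refl , b<v) rewrite ≤⇒≤ᵇ≡true x≤b | ≤⇒≤ᵇ≡true (<⇒≤ b<v) | +-identityʳ i = refl
minGE-hit i (a ∷ pre) suf (a<x ∷ pre<x) x≤b b<suf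
  rewrite minGE-hit (suc i) pre suf pre<x x≤b b<suf | >⇒≤ᵇ≡false a<x | +-suc i (length pre) = refl

-- One step of FPF-involution insertion.  insertSp runs step with fuel
-- 3·size+3, which is at least three.

insertSp-unfold : ∀ a T → insertSp a T ≡ step (suc (suc (suc (3 * size T)))) (row 0) a T
insertSp-unfold a T = cong (λ f → step f (row 0) a T) (+-comm (3 * size T) 3)

-- Column insertion into a one-row tableau, starting at the column just after
-- pre: every later column holds a single entry, so the value cascades to the
-- right and finally creates a box at the end of row 0 — a primed box.
column-cascade-primed : ∀ f pre x suf → StrictInc suf → All (x ≤_) suf → length suf < f →
  proj₂ (step f (col (length pre)) x ((pre ++ suf) ∷ [])) ≡ (0 , true)
column-cascade-primed (suc f) pre x [] _ _ _ rewrite lookupL-column0 pre [] | lookupL-column0 pre [] = refl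
column-cascade-primed (suc f) pre x (y ∷ suf) inc (x≤y ∷ _) (s≤s fuel)
  rewrite lookupL-column0 pre (y ∷ suf) | ≤⇒≤ᵇ≡true x≤y with x ≟ y
... | yes refl rewrite ≡ᵇ-refl x = continue (suc x) (head-below inc)
  where
  continue : ∀ v → All (v ≤_) suf → proj₂ (step f (col (suc (length pre))) v ((pre ++ x ∷ suf) ∷ [])) ≡ (0 , true)
  continue v v≤suf rewrite sym (length-snoc pre x) | sym (++-assoc pre [ x ] suf) =
    column-cascade-primed f (pre ++ [ x ]) v suf (inc-tail inc) v≤suf fuel
... | no x≢y rewrite ≢⇒≡ᵇ≡false x y x≢y | updateL-middle pre y x suf = continue y (All.map <⇒≤ (head-below inc))
  where
  continue : ∀ v → All (v ≤_) suf → proj₂ (step f (col (suc (length pre))) v ((pre ++ x ∷ suf) ∷ [])) ≡ (0 , true)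
  continue v v≤suf rewrite sym (length-snoc pre x) | sym (++-assoc pre [ x ] suf) =
    column-cascade-primed f (pre ++ [ x ]) v suf (inc-tail inc) v≤suf fuel

column-cascade : ∀ f c pre x suf R → c ≡ length pre → R ≡ pre ++ suf → StrictInc suf → All (x <_) suf →
  length suf < f → step f (col c) x (R ∷ []) ≡ ((pre ++ x ∷ suf) ∷ [] , 0 , true)
column-cascade (suc f) _ pre x [] _ refl refl _ _ _
  rewrite lookupL-column0 pre [] | lookupL-column0 pre [] = cong (λ R → R ∷ [] , 0 , true) (++-assoc pre [] [ x ])
column-cascade (suc f) _ pre x (y ∷ suf) _ refl refl inc (x<y ∷ _) (s≤s fuel)
  rewrite lookupL-column0 pre (y ∷ suf) | ≤⇒≤ᵇ≡true (<⇒≤ x<y) | ≢⇒≡ᵇ≡false x y (<⇒≢ x<y) | updateL-middle pre y x suf =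
  trans (column-cascade f (suc (length pre)) (pre ++ [ x ]) y suf (pre ++ x ∷ suf)
           (sym (length-snoc pre x)) (sym (++-assoc pre [ x ] suf)) (inc-tail inc) (head-below inc) fuel)
        (cong (λ R → R ∷ [] , 0 , true) (++-assoc pre [ x ] (y ∷ suf)))

row0-front : ∀ f x b suf → x < b → All (b <_) suf →
  step (suc f) (row 0) x ((b ∷ suf) ∷ []) ≡
    (if not (x % 2 ≡ᵇ b % 2) then step f (col 1) (x + 2) ((b ∷ suf) ∷ []) else step f (col 1) b ((x ∷ suf) ∷ []))
row0-front f x b suf x<b b<suf rewrite minGE-hit {x} {b} 0 [] suf [] (<⇒≤ x<b) b<suf | ≢⇒≡ᵇ≡false x b (<⇒≢ x<b) = refl

row0-append : ∀ f x R S → All (_< x) R → step (suc f) (row 0) x (R ∷ S) ≡ ((R ++ [ x ]) ∷ S , 0 , false)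
row0-append f x R S R<x rewrite minGE-none 0 R R<x = refl

row0-equal : ∀ f x pre suf S → All (_< x) pre → All (x <_) suf → All (_< suc x) (rowAt S 0) →
  step (suc (suc f)) (row 0) x ((pre ++ x ∷ suf) ∷ S) ≡ ((pre ++ x ∷ suf) ∷ appendAt S 0 (suc x) , 1 , false)
row0-equal f x pre suf S pre<x x<suf S<x+1
  rewrite minGE-hit {x} {x} 0 pre suf pre<x ≤-refl x<suf | ≡ᵇ-refl x | minGE-none 0 (rowAt S 0) S<x+1 = refl

row0-bump : ∀ f x a pre b suf S → All (_< x) (a ∷ pre) → x < b → All (b <_) suf → All (_< b) (rowAt S 0) →
  step (suc (suc f)) (row 0) x (((a ∷ pre) ++ b ∷ suf) ∷ S) ≡ (((a ∷ pre) ++ x ∷ suf) ∷ appendAt S 0 b , 1 , false)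
row0-bump f x a pre b suf S pre<x x<b b<suf S<b
  rewrite minGE-hit {x} {b} 0 (a ∷ pre) suf pre<x (<⇒≤ x<b) b<suf | ≢⇒≡ᵇ≡false x b (<⇒≢ x<b)
        | updateL-middle pre b x suf | minGE-none 0 (rowAt S 0) S<b = refl

Entry : Set
Entry = ℕ × Letter

label : Entry → ℕ
label e = proj₁ (proj₂ e)

addBoxes : Tab Letter → List Entry → Tab Letter
addBoxes Q [] = Q
addBoxes Q ((r , e) ∷ L) = addBoxes (appendAt Q r e) L

insertAll : List ℕ → Tab ℕ → Tab ℕ
insertAll [] P = P
insertAll (a ∷ w) P = insertAll w (proj₁ (insertSp a P))

insertionLog : ℕ → List ℕ → Tab ℕ → List Entry
insertionLog k [] P = []
insertionLog k (a ∷ w) P =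
  (proj₁ (proj₂ (insertSp a P)) , (k , proj₂ (proj₂ (insertSp a P)))) ∷ insertionLog (suc k) w (proj₁ (insertSp a P))

pqGo-split : ∀ k w P Q → pqGo k w P Q ≡ (insertAll w P , addBoxes Q (insertionLog k w P))
pqGo-split k [] P Q = refl
pqGo-split k (a ∷ w) P Q = pqGo-split (suc k) w _ _

P-Sp-insertAll : ∀ w → P-Sp w ≡ insertAll w []
P-Sp-insertAll w = cong proj₁ (pqGo-split 1 w [] [])

insertAll-++ : ∀ u v P → insertAll (u ++ v) P ≡ insertAll v (insertAll u P)
insertAll-++ [] v P = refl
insertAll-++ (x ∷ u) v P = insertAll-++ u v _

insertionLog-++ : ∀ k u v P →
  insertionLog k (u ++ v) P ≡ insertionLog k u P ++ insertionLog (k + length u) v (insertAll u P)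
insertionLog-++ k [] v P rewrite +-identityʳ k = refl
insertionLog-++ k (x ∷ u) v P rewrite +-suc k (length u) = cong (_ ∷_) (insertionLog-++ (suc k) u v _)

addBoxes-++ : ∀ Q L₁ L₂ → addBoxes Q (L₁ ++ L₂) ≡ addBoxes (addBoxes Q L₁) L₂
addBoxes-++ Q [] L₂ = refl
addBoxes-++ Q ((r , e) ∷ L₁) L₂ = addBoxes-++ _ L₁ L₂

labels-from : ∀ k w P → All (λ e → k ≤ label e) (insertionLog k w P)
labels-from k [] P = []
labels-from k (a ∷ w) P = ≤-refl ∷ All.map (≤-trans (n≤1+n k)) (labels-from (suc k) w _)

labels-below : ∀ k w P → All (λ e → label e < k + length w) (insertionLog k w P)
labels-below k [] P = []
labels-below k (a ∷ w) P rewrite +-suc k (length w) = s≤s (m≤m+n k (length w)) ∷ labels-below (suc k) w _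

insertionLog-step : ∀ {x T T′ r primed} k W → insertSp x T ≡ (T′ , r , primed) →
  insertionLog k (x ∷ W) T ≡ (r , (k , primed)) ∷ insertionLog (suc k) W T′
insertionLog-step k W eq rewrite eq = refl

insertAll-step : ∀ {x T T′ r primed} W → insertSp x T ≡ (T′ , r , primed) → insertAll (x ∷ W) T ≡ insertAll W T′
insertAll-step W eq rewrite eq = refl

UnprimedRow0 : Entry → Set
UnprimedRow0 e = proj₁ e ≡ 0 × proj₂ (proj₂ e) ≡ false

inc-prefix-below : ∀ R {y ys} → StrictInc (R ++ y ∷ ys) → All (_< y) R
inc-prefix-below [] _ = []
inc-prefix-below (r ∷ R) inc = All.lookup (head-below inc) (∈-++⁺ʳ R (here refl)) ∷ inc-prefix-below R (inc-tail inc)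

insert-at-end : ∀ R y → All (_< y) R → insertSp y (R ∷ []) ≡ ((R ++ [ y ]) ∷ [] , 0 , false)
insert-at-end R y R<y = trans (insertSp-unfold y (R ∷ [])) (row0-append _ y R [] R<y)

insertAll-increasing : ∀ R ys → StrictInc (R ++ ys) → insertAll ys (R ∷ []) ≡ (R ++ ys) ∷ []
insertAll-increasing R [] _ rewrite ++-identityʳ R = refl
insertAll-increasing R (y ∷ ys) inc rewrite insert-at-end R y (inc-prefix-below R inc) =
  trans (insertAll-increasing (R ++ [ y ]) ys (subst StrictInc (sym (++-assoc R [ y ] ys)) inc))
        (cong (_∷ []) (++-assoc R [ y ] ys))

insertionLog-increasing : ∀ k R ys → StrictInc (R ++ ys) → All UnprimedRow0 (insertionLog k ys (R ∷ []))
insertionLog-increasing k R [] _ = []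
insertionLog-increasing k R (y ∷ ys) inc rewrite insert-at-end R y (inc-prefix-below R inc) =
  (refl , refl) ∷ insertionLog-increasing (suc k) (R ++ [ y ]) ys (subst StrictInc (sym (++-assoc R [ y ] ys)) inc)

addBoxes-row0 : ∀ R L → All UnprimedRow0 L → addBoxes (R ∷ []) L ≡ (R ++ map proj₂ L) ∷ []
addBoxes-row0 R [] [] rewrite ++-identityʳ R = refl
addBoxes-row0 R ((.0 , e) ∷ L) ((refl , _) ∷ row0) =
  trans (addBoxes-row0 (R ++ [ e ]) L row0) (cong (_∷ []) (++-assoc R [ e ] (map proj₂ L)))

first-block-P : ∀ a ys → StrictInc (a ∷ ys) → insertAll (a ∷ ys) [] ≡ (a ∷ ys) ∷ []
first-block-P a ys inc = insertAll-increasing (a ∷ []) ys inc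

first-block-log : ∀ k a ys → StrictInc (a ∷ ys) → All UnprimedRow0 (insertionLog k (a ∷ ys) [])
first-block-log k a ys inc = (refl , refl) ∷ insertionLog-increasing (suc k) (a ∷ []) ys inc

first-block-Q : ∀ k a ys → StrictInc (a ∷ ys) →
  addBoxes [] (insertionLog k (a ∷ ys) []) ≡ map proj₂ (insertionLog k (a ∷ ys) []) ∷ []
first-block-Q k a ys inc = addBoxes-row0 ((k , false) ∷ []) _ (insertionLog-increasing (suc k) (a ∷ []) ys inc)

firstInRow0 : List Entry → Maybe Letter
firstInRow0 [] = nothing
firstInRow0 ((zero , e) ∷ L) = just e
firstInRow0 ((suc r , e) ∷ L) = firstInRow0 L

-- The letters of the second block do not put a primed box into row 0.
-- Suppose row 0 of P starts with h ≤ lo and every letter still to come from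
-- the second block exceeds lo.  Such a letter x never reaches the diagonal
-- box: it is appended to row 0 (an unprimed box), or it is equal to an
-- entry (x+1 goes to row 1), or it bumps an entry b into row 1.  In the last
-- two cases the value sent down exceeds all of row 1 and is appended there;
-- this needs the invariant Row1Below relating row 1 to row 0.

-- Harmless k m : the first letter m written into row 0 is unprimed, or it was
-- written by a letter of label at least k (i.e. not by the second block).
Harmless : ℕ → Maybe Letter → Set
Harmless k nothing = ⊤
Harmless k (just (j , primed)) = primed ≡ false ⊎ k ≤ j

harmless-late : ∀ k L → All (λ e → k ≤ label e) L → Harmless k (firstInRow0 L)
harmless-late k [] [] = tt
harmless-late k ((zero , e) ∷ L) (k≤j ∷ _) = inj₂ k≤j
harmless-late k ((suc r , e) ∷ L) (_ ∷ late) = harmless-late k L late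

Row1Below : ℕ → List ℕ → List ℕ → Set
Row1Below lo R C = (∀ {c e} → c ∈ C → e ∈ R → lo < e → c ≤ e) × (∀ {c e} → c ∈ C → e ∈ R → suc lo < e → c < e)

row1-empty : ∀ lo R → Row1Below lo R []
row1-empty lo R = (λ ()) , (λ ())

∈-after : ∀ (pre : List ℕ) {x e suf} → All (_< x) pre → e ∈ pre ++ x ∷ suf → x < e → e ∈ suf
∈-after pre pre<x e∈ x<e with ∈-++⁻ pre e∈
... | inj₁ e∈pre = ⊥-elim (<-irrefl refl (<-trans x<e (All.lookup pre<x e∈pre)))
... | inj₂ (here refl) = ⊥-elim (<-irrefl refl x<e)
... | inj₂ (there e∈suf) = e∈suf

∈-middle : ∀ (pre : List ℕ) {x suf} → x ∈ pre ++ x ∷ suf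
∈-middle pre = ∈-++⁺ʳ pre (here refl)

∈-suffix : ∀ (pre : List ℕ) {x e suf} → e ∈ suf → e ∈ pre ++ x ∷ suf
∈-suffix pre e∈suf = ∈-++⁺ʳ pre (there e∈suf)

∈-snoc : ∀ (C : List ℕ) {v c} → c ∈ C ++ [ v ] → c ∈ C ⊎ c ≡ v
∈-snoc C c∈ with ∈-++⁻ C c∈
... | inj₁ c∈C = inj₁ c∈C
... | inj₂ (here refl) = inj₂ refl

row1-below-equal : ∀ {lo x} pre suf C → lo < x → All (_< x) pre →
  Row1Below lo (pre ++ x ∷ suf) C → Row1Below x (pre ++ x ∷ suf) (C ++ [ suc x ])
row1-below-equal {lo} {x} pre suf C lo<x pre<x (weak , strict) = weak′ , strict′
  where
  weak′ : ∀ {c e} → c ∈ C ++ [ suc x ] → e ∈ pre ++ x ∷ suf → x < e → c ≤ e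
  weak′ c∈ e∈ x<e with ∈-snoc C c∈
  ... | inj₁ c∈C = weak c∈C (∈-suffix pre (∈-after pre pre<x e∈ x<e)) (<-trans lo<x x<e)
  ... | inj₂ refl = x<e
  strict′ : ∀ {c e} → c ∈ C ++ [ suc x ] → e ∈ pre ++ x ∷ suf → suc x < e → c < e
  strict′ c∈ e∈ x+1<e with ∈-snoc C c∈
  ... | inj₁ c∈C = strict c∈C e∈ (≤-trans (s≤s lo<x) (<⇒≤ x+1<e))
  ... | inj₂ refl = x+1<e

row1-below-bump : ∀ {lo x b} pre suf C → lo < x → All (_< x) pre → All (b <_) suf →
  Row1Below lo (pre ++ b ∷ suf) C → Row1Below x (pre ++ x ∷ suf) (C ++ [ b ])
row1-below-bump {lo} {x} {b} pre suf C lo<x pre<x b<suf (weak , strict) = weak′ , strict′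
  where
  weak′ : ∀ {c e} → c ∈ C ++ [ b ] → e ∈ pre ++ x ∷ suf → x < e → c ≤ e
  weak′ c∈ e∈ x<e with ∈-snoc C c∈
  ... | inj₁ c∈C = weak c∈C (∈-suffix pre (∈-after pre pre<x e∈ x<e)) (<-trans lo<x x<e)
  ... | inj₂ refl = <⇒≤ (All.lookup b<suf (∈-after pre pre<x e∈ x<e))
  strict′ : ∀ {c e} → c ∈ C ++ [ b ] → e ∈ pre ++ x ∷ suf → suc x < e → c < e
  strict′ c∈ e∈ x+1<e with ∈-snoc C c∈ | ∈-after pre pre<x e∈ (<-trans (n<1+n x) x+1<e)
  ... | inj₁ c∈C | e∈suf = strict c∈C (∈-suffix pre e∈suf) (≤-trans (s≤s lo<x) (<⇒≤ x+1<e))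
  ... | inj₂ refl | e∈suf = All.lookup b<suf e∈suf

harmless-shift : ∀ k (ws : List ℕ) m → Harmless (suc k + length ws) m → Harmless (k + suc (length ws)) m
harmless-shift k ws m h rewrite +-suc k (length ws) = h

second-block-harmless : ∀ ws rs k lo h R′ S → StrictInc (h ∷ R′) → h ≤ lo → StrictInc (lo ∷ ws) →
  Row1Below lo (h ∷ R′) (rowAt S 0) →
  Harmless (k + length ws) (firstInRow0 (insertionLog k (ws ++ rs) ((h ∷ R′) ∷ S)))
second-block-harmless [] rs k lo h R′ S _ _ _ _ rewrite +-identityʳ k = harmless-late k _ (labels-from k rs _)
second-block-harmless (x ∷ ws) rs k lo h R′ S incR h≤lo (lo<x ∷ incW) below@(_ , strict) with split-at x (h ∷ R′)
... | inj₁ R<x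
  rewrite insertionLog-step {x} {(h ∷ R′) ∷ S} k (ws ++ rs) (trans (insertSp-unfold x ((h ∷ R′) ∷ S)) (row0-append _ x (h ∷ R′) S R<x)) =
  inj₁ refl
... | inj₂ ([] , b , suf , refl , _ , x≤h) = ⊥-elim (<-irrefl refl (≤-<-trans h≤lo (<-≤-trans lo<x x≤h)))
... | inj₂ (a ∷ pre , b , suf , refl , pre<x , x≤b) with x ≟ b
...   | yes refl
  rewrite insertionLog-step {x} {((a ∷ pre) ++ x ∷ suf) ∷ S} k (ws ++ rs) (trans (insertSp-unfold x (((a ∷ pre) ++ x ∷ suf) ∷ S))
            (row0-equal _ x (a ∷ pre) suf S pre<x (head-below (inc-drop (a ∷ pre) incR))
              (tabulate (λ c∈ → s≤s (proj₁ below c∈ (∈-middle (a ∷ pre)) lo<x))))) =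
  harmless-shift k ws _
    (second-block-harmless ws rs (suc k) x a (pre ++ x ∷ suf) (appendAt S 0 (suc x)) incR (<⇒≤ (All.head pre<x)) incW
      (subst (Row1Below x ((a ∷ pre) ++ x ∷ suf)) (sym (rowAt-appendAt S (suc x)))
        (row1-below-equal (a ∷ pre) suf (rowAt S 0) lo<x pre<x below)))
...   | no x≢b
  rewrite insertionLog-step {x} {((a ∷ pre) ++ b ∷ suf) ∷ S} k (ws ++ rs) (trans (insertSp-unfold x (((a ∷ pre) ++ b ∷ suf) ∷ S))
            (row0-bump _ x a pre b suf S pre<x (≤∧≢⇒< x≤b x≢b) (head-below (inc-drop (a ∷ pre) incR))
              (tabulate (λ c∈ → strict c∈ (∈-middle (a ∷ pre)) (≤-<-trans lo<x (≤∧≢⇒< x≤b x≢b)))))) =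
  harmless-shift k ws _
    (second-block-harmless ws rs (suc k) x a (pre ++ x ∷ suf) (appendAt S 0 b)
      (inc-replace (a ∷ pre) incR pre<x x≤b) (<⇒≤ (All.head pre<x)) incW
      (subst (Row1Below x ((a ∷ pre) ++ x ∷ suf)) (sym (rowAt-appendAt S b))
        (row1-below-bump (a ∷ pre) suf (rowAt S 0) lo<x pre<x (head-below (inc-drop (a ∷ pre) incR)) below)))

lowerRows : {A : Set} → Tab A → Tab A
lowerRows [] = []
lowerRows (_ ∷ rows) = rows

prefixRow0 : List Letter → Tab Letter → Tab Letter
prefixRow0 r T = (r ++ rowAt T 0) ∷ lowerRows T

addBoxes-prefix : ∀ r rows L → addBoxes (r ∷ rows) L ≡ prefixRow0 r (addBoxes ([] ∷ rows) L)
addBoxes-prefix r rows [] = cong (_∷ rows) (sym (++-identityʳ r))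
addBoxes-prefix r rows ((zero , e) ∷ L) =
  trans (addBoxes-prefix (r ++ [ e ]) rows L)
    (trans (cong (_∷ lowerRows T) (++-assoc r [ e ] _)) (cong (prefixRow0 r) (sym (addBoxes-prefix [ e ] rows L))))
  where
  T : Tab Letter
  T = addBoxes ([] ∷ rows) L
addBoxes-prefix r rows ((suc n , e) ∷ L) = addBoxes-prefix r (appendAt rows n e) L

addBoxes-first : ∀ rows L → lookupL (rowAt (addBoxes ([] ∷ rows) L) 0) 0 ≡ firstInRow0 L
addBoxes-first rows [] = refl
addBoxes-first rows ((zero , e) ∷ L) rewrite addBoxes-prefix [ e ] rows L = refl
addBoxes-first rows ((suc n , e) ∷ L) = addBoxes-first (appendAt rows n e) L

All-appendAt : ∀ {A : Set} {P : A → Set} Q r e → All (All P) Q → P e → All (All P) (appendAt Q r e)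
All-appendAt [] zero e [] pe = (pe ∷ []) ∷ []
All-appendAt [] (suc r) e [] pe = [] ∷ All-appendAt [] r e [] pe
All-appendAt (R ∷ Q) zero e (p-row ∷ pQ) pe = AllP.++⁺ p-row (pe ∷ []) ∷ pQ
All-appendAt (R ∷ Q) (suc r) e (p-row ∷ pQ) pe = p-row ∷ All-appendAt Q r e pQ pe

All-addBoxes : ∀ {P : Letter → Set} Q L → All (All P) Q → All (P ∘ proj₂) L → All (All P) (addBoxes Q L)
All-addBoxes Q [] pQ [] = pQ
All-addBoxes Q ((r , e) ∷ L) pQ (pe ∷ pL) = All-addBoxes (appendAt Q r e) L (All-appendAt Q r e pQ pe) pL

All-row0 : ∀ {A : Set} {P : A → Set} (T : Tab A) → All (All P) T → All P (rowAt T 0)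
All-row0 [] _ = []
All-row0 (r ∷ T) (p ∷ _) = p

relabelLog : (Letter → Letter) → List Entry → List Entry
relabelLog f = map (λ e → proj₁ e , f (proj₂ e))

map-appendAt : ∀ {A B : Set} (f : A → B) Q r e → map (map f) (appendAt Q r e) ≡ appendAt (map (map f) Q) r (f e)
map-appendAt f [] zero e = refl
map-appendAt f [] (suc r) e = cong ([] ∷_) (map-appendAt f [] r e)
map-appendAt f (R ∷ Q) zero e = cong (_∷ map (map f) Q) (map-++ f R [ e ])
map-appendAt f (R ∷ Q) (suc r) e = cong (map f R ∷_) (map-appendAt f Q r e)

map-addBoxes : ∀ (f : Letter → Letter) Q L → map (map f) (addBoxes Q L) ≡ addBoxes (map (map f) Q) (relabelLog f L)
map-addBoxes f Q [] = refl
map-addBoxes f Q ((r , e) ∷ L) =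
  trans (map-addBoxes f (appendAt Q r e) L) (cong (λ T → addBoxes T (relabelLog f L)) (map-appendAt f Q r e))

firstInRow0-relabel : ∀ f L → firstInRow0 (relabelLog f L) ≡ Maybe.map f (firstInRow0 L)
firstInRow0-relabel f [] = refl
firstInRow0-relabel f ((zero , e) ∷ L) = refl
firstInRow0-relabel f ((suc r , e) ∷ L) = firstInRow0-relabel f L

relabelLog-cong : ∀ f g K L → All (λ e → K ≤ label e) L → (∀ e → K ≤ proj₁ e → f e ≡ g e) →
  relabelLog f L ≡ relabelLog g L
relabelLog-cong f g K [] [] _ = refl
relabelLog-cong f g K (e ∷ L) (late ∷ lates) f≗g =
  cong₂ _∷_ (cong (proj₁ e ,_) (f≗g (proj₂ e) late)) (relabelLog-cong f g K L lates f≗g)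

toBlock : List ℕ → Letter → Letter
toBlock ns e = blockOf ns (proj₁ e) , proj₂ e

later : (Letter → Letter) → List Entry → Tab Letter
later f L = addBoxes ([] ∷ []) (relabelLog f L)

later-first : ∀ f L → lookupL (rowAt (later f L) 0) 0 ≡ Maybe.map f (firstInRow0 L)
later-first f L = trans (addBoxes-first [] (relabelLog f L)) (firstInRow0-relabel f L)

blockOf-positive : ∀ ns k → 1 ≤ blockOf ns k
blockOf-positive [] k = s≤s z≤n
blockOf-positive (n ∷ ns) k with k ≤ᵇ n
... | true = s≤s z≤n
... | false = s≤s z≤n

blockOf-first : ∀ p ns k → k ≤ p → blockOf (p ∷ ns) k ≡ 1
blockOf-first p ns k k≤p rewrite ≤⇒≤ᵇ≡true k≤p = refl

blockOf-after-first : ∀ p ns k → p < k → 2 ≤ blockOf (p ∷ ns) k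
blockOf-after-first p ns k p<k rewrite >⇒≤ᵇ≡false p<k = s≤s (blockOf-positive ns _)

blockOf-second : ∀ p q ms → blockOf (p ∷ suc q ∷ ms) (suc p) ≡ 2
blockOf-second p q ms rewrite >⇒≤ᵇ≡false {suc p} {p} ≤-refl | m+n∸n≡m 1 p = refl

∸-below : ∀ p q k → p + q < k → q < k ∸ p
∸-below zero q k p+q<k = p+q<k
∸-below (suc p) q (suc k) (s≤s p+q<k) = ∸-below p q k p+q<k

blockOf-after-second : ∀ p q ms k → p + q < k → 3 ≤ blockOf (p ∷ q ∷ ms) k
blockOf-after-second p q ms k p+q<k
  rewrite >⇒≤ᵇ≡false {k} {p} (≤-<-trans (m≤m+n p q) p+q<k) | >⇒≤ᵇ≡false (∸-below p q k p+q<k) =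
  s≤s (s≤s (blockOf-positive ms _))

blockOf-shift-boundary : ∀ a b ms k → suc a < k → blockOf (suc a ∷ b ∷ ms) k ≡ blockOf (a ∷ suc b ∷ ms) k
blockOf-shift-boundary a b ms (suc (suc k)) (s≤s (s≤s a<k))
  rewrite >⇒≤ᵇ≡false {suc (suc k)} {suc a} (s≤s (s≤s a<k)) | >⇒≤ᵇ≡false {suc (suc k)} {a} (s≤s (≤-trans a<k (n≤1+n _))) =
  cong suc (rest a (suc k) (≤-trans a<k (n≤1+n k)))
  where
  rest : ∀ a k → a ≤ k → blockOf (b ∷ ms) (k ∸ a) ≡ blockOf (suc b ∷ ms) (suc k ∸ a)
  rest zero zero _ = refl
  rest zero (suc k) _ = refl
  rest (suc a) (suc k) (s≤s a≤k) = rest a k a≤k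

toBlock-shift-boundary : ∀ a q ms L → All (λ e → suc (suc a) ≤ label e) L →
  relabelLog (toBlock (suc a ∷ q ∷ ms)) L ≡ relabelLog (toBlock (a ∷ suc q ∷ ms)) L
toBlock-shift-boundary a q ms L late =
  relabelLog-cong _ _ (suc (suc a)) L late (λ e a+1<k → cong (_, proj₂ e) (blockOf-shift-boundary a q ms (proj₁ e) a+1<k))

one : Letter
one = 1 , false

AtLeast2 : Letter → Set
AtLeast2 e = 2 ≤ proj₁ e

rightmost1-none : ∀ i X → All AtLeast2 X → rightmost1 i X ≡ nothing
rightmost1-none i [] [] = refl
rightmost1-none i ((v , _) ∷ X) (2≤v ∷ X≥2)
  rewrite rightmost1-none (suc i) X X≥2 | ≢⇒≡ᵇ≡false v 1 (λ { refl → <-irrefl refl 2≤v }) = refl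

rightmost1-++ : ∀ i xs ys → rightmost1 (i + length xs) ys ≡ nothing → rightmost1 i (xs ++ ys) ≡ rightmost1 i xs
rightmost1-++ i [] ys none rewrite +-identityʳ i = none
rightmost1-++ i ((v , _) ∷ xs) ys none
  rewrite rightmost1-++ (suc i) xs ys (subst (λ j → rightmost1 j ys ≡ nothing) (+-suc i (length xs)) none) = refl

rightmost1-ones : ∀ i n → rightmost1 i (replicate (suc n) one) ≡ just (i + n)
rightmost1-ones i zero rewrite +-identityʳ i = refl
rightmost1-ones i (suc n) rewrite rightmost1-ones (suc i) n | +-suc i n = refl

rightmost1-prefix : ∀ n X → All AtLeast2 X → rightmost1 0 (replicate (suc n) one ++ X) ≡ just n
rightmost1-prefix n X X≥2 = trans (rightmost1-++ 0 (replicate (suc n) one) X (rightmost1-none _ X X≥2)) (rightmost1-ones 0 n)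

lookupL-ones : ∀ {A : Set} n (a : A) ys → lookupL (replicate n a ++ ys) n ≡ lookupL ys 0
lookupL-ones zero a ys = refl
lookupL-ones (suc n) a ys = lookupL-ones n a ys

updateL-ones : ∀ {A : Set} n (a b : A) ys → updateL (replicate (suc n) a ++ ys) n b ≡ (replicate n a ++ [ b ]) ++ ys
updateL-ones zero a b ys = refl
updateL-ones (suc n) a b ys = cong (a ∷_) (updateL-ones n a b ys)

fP-primes-last-one : ∀ n X T → All AtLeast2 X → is2' (lookupL X 0) ≡ false →
  fP ((replicate (suc (suc n)) one ++ X) ∷ T) ≡ just (((replicate (suc n) one ++ [ (2 , true) ]) ++ X) ∷ T)
fP-primes-last-one n X T X≥2 not2′
  rewrite rightmost1-prefix (suc n) X X≥2 | lookupL-ones (suc (suc n)) one X | not2′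
        | updateL-ones (suc n) one (2 , true) X = refl

fP-raises-diagonal : ∀ X T → All AtLeast2 X → is2' (lookupL X 0) ≡ false →
  fP ((one ∷ X) ∷ T) ≡ just (((2 , false) ∷ X) ∷ T)
fP-raises-diagonal X T X≥2 not2′ rewrite rightmost1-prefix 0 X X≥2 | not2′ = refl

fP-blocked : ∀ n X T → All AtLeast2 X → lookupL X 0 ≡ just (2 , true) → fP ((replicate (suc n) one ++ X) ∷ T) ≡ nothing
fP-blocked zero X T X≥2 is2′ rewrite rightmost1-prefix 0 X X≥2 | is2′ = refl
fP-blocked (suc n) X T X≥2 is2′ rewrite rightmost1-prefix (suc n) X X≥2 | lookupL-ones (suc (suc n)) one X | is2′ = refl

fP-no-one : ∀ Q → All (All AtLeast2) Q → fP Q ≡ nothing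
fP-no-one [] _ = refl
fP-no-one (r ∷ Q) (r≥2 ∷ _) rewrite rightmost1-none 0 r r≥2 = refl

later-row0-AtLeast2 : ∀ p ns L → All (λ e → suc p ≤ label e) L → All AtLeast2 (rowAt (later (toBlock (p ∷ ns)) L) 0)
later-row0-AtLeast2 p ns L late =
  All-row0 (later (toBlock (p ∷ ns)) L)
    (All-addBoxes ([] ∷ []) (relabelLog (toBlock (p ∷ ns)) L) ([] ∷ [])
      (AllP.map⁺ (All.map (λ {e} p<k → blockOf-after-first p ns (label e) p<k) late)))

harmless-not-2′ : ∀ p q ms m → Harmless (suc p + q) m → is2' (Maybe.map (toBlock (p ∷ q ∷ ms)) m) ≡ false
harmless-not-2′ p q ms nothing _ = refl
harmless-not-2′ p q ms (just (k , .false)) (inj₁ refl) = ∧-zeroʳ _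
harmless-not-2′ p q ms (just (k , primed)) (inj₂ late)
  rewrite ≢⇒≡ᵇ≡false (blockOf (p ∷ q ∷ ms) k) 2 (λ eq → <-irrefl (sym eq) (blockOf-after-second p q ms k late)) = refl

Q-SpF-log : ∀ bs → Q-SpF bs ≡ map (map (toBlock (map length bs))) (addBoxes [] (insertionLog 1 (concat bs) []))
Q-SpF-log bs = cong (λ PQ → map (map (toBlock (map length bs))) (proj₂ PQ)) (pqGo-split 1 (concat bs) [] [])

length-insertionLog : ∀ k w P → length (insertionLog k w P) ≡ length w
length-insertionLog k [] P = refl
length-insertionLog k (a ∷ w) P = cong suc (length-insertionLog (suc k) w _)

map-constant : ∀ {A B : Set} (f : A → B) c xs → All (λ x → f x ≡ c) xs → map f xs ≡ replicate (length xs) c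
map-constant f c [] [] = refl
map-constant f c (x ∷ xs) (fx≡c ∷ fxs≡c) = cong₂ _∷_ fx≡c (map-constant f c xs fxs≡c)

first-block-ones : ∀ a t ms → StrictInc (a ∷ t) →
  map (toBlock (suc (length t) ∷ ms)) (map proj₂ (insertionLog 1 (a ∷ t) [])) ≡ replicate (suc (length t)) one
first-block-ones a t ms inc =
  trans (map-constant _ one _ (in-block-1 _ (first-block-log 1 a t inc) (labels-below 1 (a ∷ t) [])))
    (cong (λ n → replicate n one) (trans (length-map proj₂ (insertionLog 1 (a ∷ t) [])) (length-insertionLog 1 (a ∷ t) [])))
  where
  in-block-1 : ∀ L → All UnprimedRow0 L → All (λ e → label e < suc (suc (length t))) L →
    All (λ e → toBlock (suc (length t) ∷ ms) e ≡ one) (map proj₂ L)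
  in-block-1 [] [] [] = []
  in-block-1 ((_ , (k , _)) ∷ L) ((_ , refl) ∷ row0) (k<p ∷ ks) =
    cong (_, false) (blockOf-first (suc (length t)) ms k (≤-pred k<p)) ∷ in-block-1 L row0 ks

Q-SpF-first-block : ∀ u t0 w2 rest → StrictInc (u ∷ t0) →
  Q-SpF ((u ∷ t0) ∷ w2 ∷ rest) ≡
    prefixRow0 (replicate (suc (length t0)) one)
      (later (toBlock (suc (length t0) ∷ length w2 ∷ map length rest))
        (insertionLog (suc (suc (length t0))) (w2 ++ concat rest) ((u ∷ t0) ∷ [])))
Q-SpF-first-block u t0 w2 rest inc = begin
  Q-SpF ((u ∷ t0) ∷ w2 ∷ rest)
    ≡⟨ Q-SpF-log ((u ∷ t0) ∷ w2 ∷ rest) ⟩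
  map (map f) (addBoxes [] (insertionLog 1 ((u ∷ t0) ++ W) []))
    ≡⟨ cong (λ L → map (map f) (addBoxes [] L)) (insertionLog-++ 1 (u ∷ t0) W []) ⟩
  map (map f) (addBoxes [] (L₁ ++ insertionLog (suc p) W (insertAll (u ∷ t0) [])))
    ≡⟨ cong (λ P → map (map f) (addBoxes [] (L₁ ++ insertionLog (suc p) W P))) (first-block-P u t0 inc) ⟩
  map (map f) (addBoxes [] (L₁ ++ L))
    ≡⟨ cong (map (map f)) (addBoxes-++ [] L₁ L) ⟩
  map (map f) (addBoxes (addBoxes [] L₁) L)
    ≡⟨ cong (λ Q → map (map f) (addBoxes Q L)) (first-block-Q 1 u t0 inc) ⟩
  map (map f) (addBoxes (map proj₂ L₁ ∷ []) L)
    ≡⟨ map-addBoxes f _ L ⟩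
  addBoxes (map f (map proj₂ L₁) ∷ []) (relabelLog f L)
    ≡⟨ cong (λ r → addBoxes (r ∷ []) (relabelLog f L)) (first-block-ones u t0 (length w2 ∷ map length rest) inc) ⟩
  addBoxes (replicate p one ∷ []) (relabelLog f L)
    ≡⟨ addBoxes-prefix (replicate p one) [] (relabelLog f L) ⟩
  prefixRow0 (replicate p one) (later f L) ∎
  where
  p : ℕ
  p = suc (length t0)
  W : List ℕ
  W = w2 ++ concat rest
  f : Letter → Letter
  f = toBlock (p ∷ length w2 ∷ map length rest)
  L₁ L : List Entry
  L₁ = insertionLog 1 (u ∷ t0) []
  L = insertionLog (suc p) W ((u ∷ t0) ∷ [])

Q-SpF-primed-second : ∀ a t x w2 rest R → StrictInc (a ∷ t) → insertSp x ((a ∷ t) ∷ []) ≡ (R ∷ [] , 0 , true) →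
  Q-SpF ((a ∷ t) ∷ (x ∷ w2) ∷ rest) ≡
    prefixRow0 (replicate (suc (length t)) one ++ [ (2 , true) ])
      (later (toBlock (suc (length t) ∷ suc (length w2) ∷ map length rest))
        (insertionLog (suc (suc (suc (length t)))) (w2 ++ concat rest) (R ∷ [])))
Q-SpF-primed-second a t x w2 rest R inc ins = begin
  Q-SpF ((a ∷ t) ∷ (x ∷ w2) ∷ rest)
    ≡⟨ Q-SpF-log ((a ∷ t) ∷ (x ∷ w2) ∷ rest) ⟩
  map (map f) (addBoxes [] (insertionLog 1 ((a ∷ t) ++ x ∷ W) []))
    ≡⟨ cong (λ L → map (map f) (addBoxes [] L)) (insertionLog-++ 1 (a ∷ t) (x ∷ W) []) ⟩
  map (map f) (addBoxes [] (L₁ ++ insertionLog (suc p) (x ∷ W) (insertAll (a ∷ t) [])))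
    ≡⟨ cong (λ P → map (map f) (addBoxes [] (L₁ ++ insertionLog (suc p) (x ∷ W) P))) (first-block-P a t inc) ⟩
  map (map f) (addBoxes [] (L₁ ++ insertionLog (suc p) (x ∷ W) ((a ∷ t) ∷ [])))
    ≡⟨ cong (λ L → map (map f) (addBoxes [] (L₁ ++ L))) (insertionLog-step {x} {(a ∷ t) ∷ []} (suc p) W ins) ⟩
  map (map f) (addBoxes [] (L₁ ++ (0 , (suc p , true)) ∷ L))
    ≡⟨ cong (map (map f)) (addBoxes-++ [] L₁ _) ⟩
  map (map f) (addBoxes (addBoxes [] L₁) ((0 , (suc p , true)) ∷ L))
    ≡⟨ cong (λ Q → map (map f) (addBoxes Q ((0 , (suc p , true)) ∷ L))) (first-block-Q 1 a t inc) ⟩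
  map (map f) (addBoxes ((map proj₂ L₁ ++ [ (suc p , true) ]) ∷ []) L)
    ≡⟨ map-addBoxes f _ L ⟩
  addBoxes (map f (map proj₂ L₁ ++ [ (suc p , true) ]) ∷ []) (relabelLog f L)
    ≡⟨ cong (λ r → addBoxes (r ∷ []) (relabelLog f L)) relabelled-row ⟩
  addBoxes ((replicate p one ++ [ (2 , true) ]) ∷ []) (relabelLog f L)
    ≡⟨ addBoxes-prefix (replicate p one ++ [ (2 , true) ]) [] (relabelLog f L) ⟩
  prefixRow0 (replicate p one ++ [ (2 , true) ]) (later f L) ∎
  where
  p : ℕ
  p = suc (length t)
  W : List ℕ
  W = w2 ++ concat rest
  f : Letter → Letter
  f = toBlock (p ∷ suc (length w2) ∷ map length rest)
  L₁ L : List Entry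
  L₁ = insertionLog 1 (a ∷ t) []
  L = insertionLog (suc (suc p)) W (R ∷ [])
  relabelled-row : map f (map proj₂ L₁ ++ [ (suc p , true) ]) ≡ replicate p one ++ [ (2 , true) ]
  relabelled-row = trans (map-++ f (map proj₂ L₁) _)
    (cong₂ _++_ (first-block-ones a t (suc (length w2) ∷ map length rest) inc)
                (cong (λ b → (b , true) ∷ []) (blockOf-second p (length w2) (map length rest))))

Q-SpF-empty-first : ∀ u w2 rest →
  Q-SpF ([] ∷ (u ∷ w2) ∷ rest) ≡
    prefixRow0 ((2 , false) ∷ [])
      (later (toBlock (0 ∷ suc (length w2) ∷ map length rest)) (insertionLog 2 (w2 ++ concat rest) ((u ∷ []) ∷ [])))
Q-SpF-empty-first u w2 rest = trans (Q-SpF-log ([] ∷ (u ∷ w2) ∷ rest))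
  (trans (map-addBoxes f (((1 , false) ∷ []) ∷ []) L) (addBoxes-prefix ((2 , false) ∷ []) [] (relabelLog f L)))
  where
  f : Letter → Letter
  f = toBlock (0 ∷ suc (length w2) ∷ map length rest)
  L : List Entry
  L = insertionLog 2 (w2 ++ concat rest) ((u ∷ []) ∷ [])

enough-fuel : ∀ b (t : List ℕ) → length t < suc (suc (3 * size ((b ∷ t) ∷ [])))
enough-fuel b t = s≤s (≤-trans (≤-trans (m≤m+n (length t) 0) (n≤1+n _)) (≤-trans (m≤m+n _ _) (n≤1+n _)))

insert-below-primed : ∀ x b t → x < b → StrictInc (b ∷ t) → proj₂ (insertSp x ((b ∷ t) ∷ [])) ≡ (0 , true)
insert-below-primed x b t x<b inc
  rewrite insertSp-unfold x ((b ∷ t) ∷ []) | row0-front (suc (suc (3 * size ((b ∷ t) ∷ [])))) x b t x<b (head-below inc) with x % 2 ≡ᵇ b % 2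
... | true = column-cascade-primed _ (x ∷ []) b t (inc-tail inc) (All.map <⇒≤ (head-below inc)) (enough-fuel b t)
... | false = column-cascade-primed _ (b ∷ []) (x + 2) t (inc-tail inc)
                (All.map (λ {e} b<e → subst (_≤ e) (sym (+-comm x 2)) (≤-trans (s≤s x<b) b<e)) (head-below inc))
                (enough-fuel b t)

insert-below-same-parity : ∀ x b t → x < b → (x % 2 ≡ᵇ b % 2) ≡ true → StrictInc (b ∷ t) →
  insertSp x ((b ∷ t) ∷ []) ≡ ((x ∷ b ∷ t) ∷ [] , 0 , true)
insert-below-same-parity x b t x<b same inc
  rewrite insertSp-unfold x ((b ∷ t) ∷ []) | row0-front (suc (suc (3 * size ((b ∷ t) ∷ [])))) x b t x<b (head-below inc) | same =
  column-cascade _ 1 (x ∷ []) b t (x ∷ t) refl refl (inc-tail inc) (head-below inc) (enough-fuel b t)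

insert-below-other-parity : ∀ x b t → x < b → b < suc (suc x) → (x % 2 ≡ᵇ b % 2) ≡ false → StrictInc (suc (suc x) ∷ t) →
  insertSp x ((b ∷ t) ∷ []) ≡ ((b ∷ suc (suc x) ∷ t) ∷ [] , 0 , true)
insert-below-other-parity x b t x<b b<x+2 other inc
  rewrite insertSp-unfold x ((b ∷ t) ∷ [])
        | row0-front (suc (suc (3 * size ((b ∷ t) ∷ [])))) x b t x<b (All.map (<-trans b<x+2) (head-below inc))
        | other | +-comm x 2 =
  column-cascade _ 1 (b ∷ []) (suc (suc x)) t (b ∷ t) refl refl (inc-tail inc) (head-below inc) (enough-fuel b t)

P-Sp-after-second-letter : ∀ a t x W r R → StrictInc (a ∷ t) → StrictInc (r ∷ R) →
  insertSp x ((a ∷ t) ∷ []) ≡ ((r ∷ R) ∷ [] , 0 , true) → P-Sp ((a ∷ t) ++ x ∷ W) ≡ P-Sp ((r ∷ R) ++ W)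
P-Sp-after-second-letter a t x W r R inc incR ins = begin
  P-Sp ((a ∷ t) ++ x ∷ W)                  ≡⟨ P-Sp-insertAll ((a ∷ t) ++ x ∷ W) ⟩
  insertAll ((a ∷ t) ++ x ∷ W) []          ≡⟨ insertAll-++ (a ∷ t) (x ∷ W) [] ⟩
  insertAll (x ∷ W) (insertAll (a ∷ t) []) ≡⟨ cong (insertAll (x ∷ W)) (first-block-P a t inc) ⟩
  insertAll (x ∷ W) ((a ∷ t) ∷ [])         ≡⟨ insertAll-step {x} {(a ∷ t) ∷ []} W ins ⟩
  insertAll W ((r ∷ R) ∷ [])               ≡⟨ cong (insertAll W) (first-block-P r R incR) ⟨
  insertAll W (insertAll (r ∷ R) [])       ≡⟨ insertAll-++ (r ∷ R) W [] ⟨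
  insertAll ((r ∷ R) ++ W) []              ≡⟨ P-Sp-insertAll ((r ∷ R) ++ W) ⟨
  P-Sp ((r ∷ R) ++ W)                      ∎

inc-cons : ∀ u w → LtMin u w → StrictInc w → StrictInc (u ∷ w)
inc-cons u [] _ _ = [-]
inc-cons u (v ∷ w) (u<v ∷ _) inc = u<v ∷ inc

inc-skip : ∀ {a b t} → StrictInc (a ∷ b ∷ t) → StrictInc (a ∷ t)
inc-skip {t = []} _ = [-]
inc-skip {t = c ∷ t} (a<b ∷ b<c ∷ inc) = <-trans a<b b<c ∷ inc

below-all : ∀ {u v w} → u < v → StrictInc (v ∷ w) → All (u <_) (v ∷ w)
below-all u<v inc = u<v ∷ All.map (<-trans u<v) (head-below inc)

All-insert : ∀ {P : ℕ → Set} pre {x W} → P x → All P (pre ++ W) → All P (pre ++ x ∷ W)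
All-insert [] px ps = px ∷ ps
All-insert (y ∷ pre) px (py ∷ ps) = py ∷ All-insert pre px ps

All-delete : ∀ {P : ℕ → Set} pre {x W} → All P (pre ++ x ∷ W) → All P (pre ++ W)
All-delete [] (_ ∷ ps) = ps
All-delete (y ∷ pre) (py ∷ ps) = py ∷ All-delete pre ps

length-insert : ∀ (pre : List ℕ) x W → length (pre ++ x ∷ W) ≡ suc (length (pre ++ W))
length-insert [] x W = refl
length-insert (y ∷ pre) x W = cong suc (length-insert pre x W)

∈-cons : ∀ {u : ℕ} {w} x → (x ∈ u ∷ w) ⇔ (x ∈ w ⊎ x ≡ u)
∈-cons x = mk⇔ (λ { (here refl) → inj₂ refl ; (there x∈w) → inj₁ x∈w })
               (λ { (inj₁ x∈w) → there x∈w ; (inj₂ refl) → here refl })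

∈-drop-first : ∀ {u w} x → StrictInc (u ∷ w) → (x ∈ w) ⇔ (x ∈ u ∷ w × x ≢ u)
∈-drop-first x inc = mk⇔ (λ x∈w → there x∈w , λ { refl → <-irrefl refl (All.lookup (head-below inc) x∈w) })
  (λ { (here refl , x≢u) → ⊥-elim (x≢u refl) ; (there x∈w , _) → x∈w })

∈-drop-second : ∀ {a b t} x → StrictInc (a ∷ b ∷ t) → (x ∈ a ∷ t) ⇔ (x ∈ a ∷ b ∷ t × x ≢ b)
∈-drop-second {a} {b} {t} x inc = mk⇔ to from
  where
  to : x ∈ a ∷ t → x ∈ a ∷ b ∷ t × x ≢ b
  to (here refl) = here refl , <⇒≢ (Linked.head inc)
  to (there x∈t) = there (there x∈t) , λ { refl → <-irrefl refl (All.lookup (head-below (inc-tail inc)) x∈t) }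
  from : x ∈ a ∷ b ∷ t × x ≢ b → x ∈ a ∷ t
  from (here refl , _) = here refl
  from (there (here refl) , x≢b) = ⊥-elim (x≢b refl)
  from (there (there x∈t) , _) = there x∈t

reduced-no-deletion : ∀ {z} pre x W → IsFPFWord z (pre ++ x ∷ W) → act (pre ++ W) ≗ act (pre ++ x ∷ W) → ⊥
reduced-no-deletion pre x W red@(pos , _) same =
  reduced-minimal red (pre ++ W) (All-delete pre pos) same (subst (length (pre ++ W) <_) (sym (length-insert pre x W)) ≤-refl)

reduced-insertion : ∀ {z} w pre x W → IsFPFWord z w → 1 ≤ x → Positive (pre ++ W) →
  length w ≡ suc (length (pre ++ W)) → act (pre ++ x ∷ W) ≗ act w → IsFPFWord z (pre ++ x ∷ W)
reduced-insertion w pre x W red 1≤x pos len same =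
  reduced-transfer red (pre ++ x ∷ W) (All-insert pre 1≤x pos) same (trans (length-insert pre x W) (sym len))

tailQ : ℕ → List ℕ → List ℕ → List (List ℕ) → Tab Letter
tailQ u t0 w2 rest =
  later (toBlock (suc (length t0) ∷ length w2 ∷ map length rest))
    (insertionLog (suc (suc (length t0))) (w2 ++ concat rest) ((u ∷ t0) ∷ []))

tailQ-AtLeast2 : ∀ u t0 w2 rest → All AtLeast2 (rowAt (tailQ u t0 w2 rest) 0)
tailQ-AtLeast2 u t0 w2 rest =
  later-row0-AtLeast2 (suc (length t0)) (length w2 ∷ map length rest) _ (labels-from (suc (suc (length t0))) (w2 ++ concat rest) ((u ∷ t0) ∷ []))

tailQ-not-2′ : ∀ u t0 w2 rest → StrictInc (u ∷ t0) → StrictInc w2 → LtMin u w2 →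
  is2' (lookupL (rowAt (tailQ u t0 w2 rest) 0) 0) ≡ false
tailQ-not-2′ u t0 w2 rest inc inc2 u<w2 =
  trans (cong is2' (later-first _ L))
    (harmless-not-2′ (suc (length t0)) (length w2) (map length rest) (firstInRow0 L)
      (second-block-harmless w2 (concat rest) (suc (suc (length t0))) u u t0 [] inc ≤-refl (inc-cons u w2 u<w2 inc2)
        (row1-empty u (u ∷ t0))))
  where
  L : List Entry
  L = insertionLog (suc (suc (length t0))) (w2 ++ concat rest) ((u ∷ t0) ∷ [])

tailQ-2′ : ∀ u t0 v w2 rest → StrictInc (u ∷ t0) → v < u →
  lookupL (rowAt (tailQ u t0 (v ∷ w2) rest) 0) 0 ≡ just (2 , true)
tailQ-2′ u t0 v w2 rest inc v<u = begin
  lookupL (rowAt (later f (insertionLog (suc p) (v ∷ W) ((u ∷ t0) ∷ []))) 0) 0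
    ≡⟨ later-first f (insertionLog (suc p) (v ∷ W) ((u ∷ t0) ∷ [])) ⟩
  Maybe.map f (firstInRow0 (insertionLog (suc p) (v ∷ W) ((u ∷ t0) ∷ [])))
    ≡⟨ cong (Maybe.map f ∘ firstInRow0) (insertionLog-step {v} {(u ∷ t0) ∷ []} (suc p) W v-primed) ⟩
  just (blockOf (p ∷ suc (length w2) ∷ map length rest) (suc p) , true)
    ≡⟨ cong (λ b → just (b , true)) (blockOf-second p (length w2) (map length rest)) ⟩
  just (2 , true) ∎
  where
  p : ℕ
  p = suc (length t0)
  W : List ℕ
  W = w2 ++ concat rest
  f : Letter → Letter
  f = toBlock (p ∷ suc (length w2) ∷ map length rest)
  v-primed : insertSp v ((u ∷ t0) ∷ []) ≡ (proj₁ (insertSp v ((u ∷ t0) ∷ [])) , 0 , true)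
  v-primed = cong (proj₁ (insertSp v ((u ∷ t0) ∷ [])) ,_) (insert-below-primed v u t0 v<u inc)

vanishes : ∀ u t0 w2 rest → StrictInc (u ∷ t0) → StrictInc w2 → ¬ LtMin u w2 → (∀ w → w2 ≢ u ∷ w) →
  FFzero ((u ∷ t0) ∷ w2 ∷ rest)
vanishes u t0 [] rest _ _ not-above _ = ⊥-elim (not-above [])
vanishes u t0 (v ∷ w2) rest inc inc2 not-above not-u with <-cmp u v
... | tri< u<v _ _ = ⊥-elim (not-above (below-all u<v inc2))
... | tri≈ _ refl _ = ⊥-elim (not-u w2 refl)
... | tri> _ _ v<u =
  trans (cong fP (Q-SpF-first-block u t0 (v ∷ w2) rest inc))
    (fP-blocked (length t0) _ _ (tailQ-AtLeast2 u t0 (v ∷ w2) rest) (tailQ-2′ u t0 v w2 rest inc v<u))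

move-to-second-block : ∀ {z} u u2 t a x w2 rest → IsRF z ((u ∷ u2 ∷ t) ∷ w2 ∷ rest) → LtMin u w2 → LtMin x w2 →
  StrictInc (a ∷ t) → insertSp x ((a ∷ t) ∷ []) ≡ ((u ∷ u2 ∷ t) ∷ [] , 0 , true) →
  IsFPFWord z ((a ∷ t) ++ x ∷ w2 ++ concat rest) →
  FF z ((u ∷ u2 ∷ t) ∷ w2 ∷ rest) ((a ∷ t) ∷ (x ∷ w2) ∷ rest)
move-to-second-block u u2 t a x w2 rest ((inc1 ∷ inc2 ∷ incs) , _) u<w2 x<w2 inc ins red′ =
  ((inc ∷ inc-cons x w2 x<w2 inc2 ∷ incs) , red′) ,
  P-Sp-after-second-letter a t x (w2 ++ concat rest) u (u2 ∷ t) inc inc1 ins ,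
  (begin
    fP (Q-SpF ((u ∷ u2 ∷ t) ∷ w2 ∷ rest))
      ≡⟨ cong fP (Q-SpF-first-block u (u2 ∷ t) w2 rest inc1) ⟩
    fP (prefixRow0 (replicate (suc (suc n)) one) T)
      ≡⟨ fP-primes-last-one n (rowAt T 0) (lowerRows T) (tailQ-AtLeast2 u (u2 ∷ t) w2 rest)
           (tailQ-not-2′ u (u2 ∷ t) w2 rest inc1 inc2 u<w2) ⟩
    just (prefixRow0 (replicate (suc n) one ++ [ (2 , true) ]) T)
      ≡⟨ cong (λ L′ → just (prefixRow0 (replicate (suc n) one ++ [ (2 , true) ]) (addBoxes ([] ∷ []) L′)))
           (toBlock-shift-boundary (suc n) (length w2) (map length rest) L (labels-from _ _ _)) ⟩
    just (prefixRow0 (replicate (suc n) one ++ [ (2 , true) ])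
      (later (toBlock (suc n ∷ suc (length w2) ∷ map length rest)) L))
      ≡⟨ cong just (Q-SpF-primed-second a t x w2 rest (u ∷ u2 ∷ t) inc ins) ⟨
    just (Q-SpF ((a ∷ t) ∷ (x ∷ w2) ∷ rest)) ∎)
  where
  n : ℕ
  n = length t
  L : List Entry
  L = insertionLog (suc (suc (suc n))) (w2 ++ concat rest) ((u ∷ u2 ∷ t) ∷ [])
  T : Tab Letter
  T = tailQ u (u2 ∷ t) w2 rest

move-single-letter : ∀ {z} u w2 rest → IsRF z ((u ∷ []) ∷ w2 ∷ rest) → LtMin u w2 →
  FF z ((u ∷ []) ∷ w2 ∷ rest) ([] ∷ (u ∷ w2) ∷ rest)
move-single-letter u w2 rest ((_ ∷ inc2 ∷ incs) , red) u<w2 =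
  (([] ∷ inc-cons u w2 u<w2 inc2 ∷ incs) , red) ,
  refl ,
  (begin
    fP (Q-SpF ((u ∷ []) ∷ w2 ∷ rest))
      ≡⟨ cong fP (Q-SpF-first-block u [] w2 rest [-]) ⟩
    fP (prefixRow0 (one ∷ []) T)
      ≡⟨ fP-raises-diagonal (rowAt T 0) (lowerRows T) (tailQ-AtLeast2 u [] w2 rest) (tailQ-not-2′ u [] w2 rest [-] inc2 u<w2) ⟩
    just (prefixRow0 ((2 , false) ∷ []) T)
      ≡⟨ cong (λ L′ → just (prefixRow0 ((2 , false) ∷ []) (addBoxes ([] ∷ []) L′)))
           (toBlock-shift-boundary 0 (length w2) (map length rest) L (labels-from 2 _ _)) ⟩
    just (prefixRow0 ((2 , false) ∷ []) (later (toBlock (0 ∷ suc (length w2) ∷ map length rest)) L))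
      ≡⟨ cong just (Q-SpF-empty-first u w2 rest) ⟨
    just (Q-SpF ([] ∷ (u ∷ w2) ∷ rest)) ∎)
  where
  L : List Entry
  L = insertionLog 2 (w2 ++ concat rest) ((u ∷ []) ∷ [])
  T : Tab Letter
  T = tailQ u [] w2 rest

square-not-reduced : ∀ {z} u X → IsFPFWord z (u ∷ u ∷ X) → ⊥
square-not-reduced u X red@((_ ∷ _ ∷ pos) , _) = reduced-minimal red X pos (≗-sym (act-cancel-square u X)) (n≤1+n _)

repeat-not-reduced : ∀ {z} u1 u2 t X → StrictInc (u1 ∷ u2 ∷ t) → IsFPFWord z (u1 ∷ u2 ∷ t ++ u1 ∷ X) → ⊥
repeat-not-reduced u1 u2 t X inc red with m≤n⇒m<n∨m≡n (Linked.head inc)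
... | inj₁ 1+u1<u2 =
  reduced-minimal red ((u2 ∷ t) ++ X) (All-delete (u2 ∷ t) (All.tail (proj₁ red))) (≗-sym (act-cancel-far u1 (u2 ∷ t) X fars))
    shorter
  where
  fars : All (FarApart u1) (u2 ∷ t)
  fars = inj₁ 1+u1<u2 ∷ All.map (λ u2<e → inj₁ (<-trans 1+u1<u2 u2<e)) (head-below (inc-tail inc))
  shorter : length ((u2 ∷ t) ++ X) < length (u1 ∷ u2 ∷ t ++ u1 ∷ X)
  shorter rewrite length-insert t u1 X = s≤s (s≤s (n≤1+n _))
repeat-not-reduced u1 .(suc u1) t X inc red | inj₂ refl with first-letter-even red
... | k , refl = reduced-no-deletion (u1 ∷ suc u1 ∷ t) u1 X red (≗-sym (act-cancel-braid k t X (All.map inj₁ (head-below (inc-tail inc)))))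

-- (1) |w¹| = 0: all labels lie in blocks ≥ 2, so row 0 of Q contains no 1.
first-empty : ∀ w1 w2 rest → w1 ≡ [] → FFzero (w1 ∷ w2 ∷ rest)
first-empty .[] w2 rest refl =
  trans (cong fP (trans (Q-SpF-log bs) (map-addBoxes f [] L)))
    (fP-no-one _ (All-addBoxes [] (relabelLog f L) []
      (AllP.map⁺ (All.map (λ {e} 0<k → blockOf-after-first 0 ns (label e) 0<k) (labels-from 1 (concat bs) [])))))
  where
  bs : List (List ℕ)
  bs = [] ∷ w2 ∷ rest
  ns : List ℕ
  ns = length w2 ∷ map length rest
  f : Letter → Letter
  f = toBlock (0 ∷ ns)
  L : List Entry
  L = insertionLog 1 (concat bs) []

-- (2) |w¹| = 1: if w² lies above u1, u1 moves into w²; otherwise 𝟎, since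
-- w² cannot start with u1.
first-single : ∀ {z} w1 w2 rest → IsRF z (w1 ∷ w2 ∷ rest) → ∀ u1 → w1 ≡ [ u1 ] →
  (LtMin u1 w2 → ∃ λ w2′ → FF z (w1 ∷ w2 ∷ rest) ([] ∷ w2′ ∷ rest) × (∀ x → (x ∈ w2′) ⇔ (x ∈ w2 ⊎ x ≡ u1))) ×
  (¬ LtMin u1 w2 → FFzero (w1 ∷ w2 ∷ rest))
first-single {z} .(u1 ∷ []) w2 rest rf@((_ ∷ inc2 ∷ _) , red) u1 refl =
  (λ u1<w2 → u1 ∷ w2 , move-single-letter u1 w2 rest rf u1<w2 , ∈-cons) ,
  (λ not-above → vanishes u1 [] w2 rest [-] inc2 not-above
    (λ w w2≡u1∷w → square-not-reduced u1 (w ++ concat rest) (subst (λ v → IsFPFWord z (u1 ∷ v ++ concat rest)) w2≡u1∷w red)))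

-- (3) |w¹| ≥ 2, u1 + 1 < u2: both are even, u1 moves into the second block.
first-long-far : ∀ {z} u1 u2 t w2 rest → IsRF z ((u1 ∷ u2 ∷ t) ∷ w2 ∷ rest) → u1 + 1 < u2 → LtMin u1 w2 →
  ∃₂ λ w1′ w2′ → FF z ((u1 ∷ u2 ∷ t) ∷ w2 ∷ rest) (w1′ ∷ w2′ ∷ rest) ×
    (∀ x → (x ∈ w1′) ⇔ (x ∈ u1 ∷ u2 ∷ t × x ≢ u1)) × (∀ x → (x ∈ w2′) ⇔ (x ∈ w2 ⊎ x ≡ u1))
first-long-far u1 u2 t w2 rest rf@((inc1 ∷ _) , red) u1+1<u2 u1<w2
  with first-letter-even red | second-letter-even red (subst (_< u2) (+-comm u1 1) u1+1<u2)
... | k1 , refl | k2 , refl =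
  u2 ∷ t , u1 ∷ w2 ,
  move-to-second-block u1 u2 t u2 u1 w2 rest rf u1<w2 u1<w2 (inc-tail inc1)
    (insert-below-same-parity u1 u2 t (Linked.head inc1) (cong₂ _≡ᵇ_ (dbl-even (suc k1)) (dbl-even (suc k2))) (inc-tail inc1))
    (reduced-insertion _ (u2 ∷ t) u1 W red (s≤s z≤n) (All.tail (proj₁ red)) refl (act-move-far u1 (u2 ∷ t) W fars)) ,
  (λ x → ∈-drop-first x inc1) , ∈-cons
  where
  W : List ℕ
  W = w2 ++ concat rest
  1+u1<u2 : suc u1 < u2
  1+u1<u2 = subst (_< u2) (+-comm u1 1) u1+1<u2
  fars : All (FarApart u1) (u2 ∷ t)
  fars = inj₁ 1+u1<u2 ∷ All.map (λ u2<e → inj₁ (<-trans 1+u1<u2 u2<e)) (head-below (inc-tail inc1))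

-- (3) |w¹| ≥ 2, u2 = u1 + 1: u1 is even, u1 - 1 enters the second block and
-- u1 + 1 leaves the first (a braid move).
first-long-adjacent : ∀ {z} u1 u2 t w2 rest → IsRF z ((u1 ∷ u2 ∷ t) ∷ w2 ∷ rest) → u2 ≡ u1 + 1 → LtMin u1 w2 →
  ∃₂ λ w1′ w2′ → FF z ((u1 ∷ u2 ∷ t) ∷ w2 ∷ rest) (w1′ ∷ w2′ ∷ rest) ×
    (∀ x → (x ∈ w1′) ⇔ (x ∈ u1 ∷ u2 ∷ t × x ≢ u1 + 1)) × (∀ x → (x ∈ w2′) ⇔ (x ∈ w2 ⊎ x ≡ u1 ∸ 1))
first-long-adjacent u1 u2 t w2 rest rf u2≡u1+1 u1<w2 with trans u2≡u1+1 (+-comm u1 1)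
first-long-adjacent u1 .(suc u1) t w2 rest rf@((inc1 ∷ _) , red) _ u1<w2 | refl with first-letter-even red
... | k , refl =
  u1 ∷ t , suc (dbl k) ∷ w2 ,
  move-to-second-block u1 (suc u1) t u1 (suc (dbl k)) w2 rest rf u1<w2 (All.map (<-trans (n<1+n _)) u1<w2) (inc-skip inc1)
    (insert-below-other-parity (suc (dbl k)) u1 t (n<1+n _) (n<1+n _) (cong₂ _≡ᵇ_ (dbl-odd k) (dbl-even (suc k))) (inc-tail inc1))
    (reduced-insertion _ (u1 ∷ t) (suc (dbl k)) W red (s≤s z≤n) (pos-u1 ∷ pos) refl (act-move-braid k t W fars)) ,
  (λ x → subst (λ c → (x ∈ u1 ∷ t) ⇔ (x ∈ u1 ∷ suc u1 ∷ t × x ≢ c)) (+-comm 1 u1) (∈-drop-second x inc1)) , ∈-cons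
  where
  W : List ℕ
  W = w2 ++ concat rest
  pos-u1 : 1 ≤ u1
  pos-u1 = s≤s z≤n
  pos : Positive (t ++ W)
  pos with proj₁ red
  ... | _ ∷ _ ∷ pos-tW = pos-tW
  fars : All (FarApart (suc (dbl k))) t
  fars = All.map (λ 1+u1<e → inj₁ (<-trans (n<1+n u1) 1+u1<e)) (head-below (inc-tail inc1))

-- (3) |w¹| ≥ 2, otherwise: the second block is not above u1, and cannot
-- start with u1, so f̃^F_{1̄} vanishes.
first-long-blocked : ∀ {z} u1 u2 t w2 rest → IsRF z ((u1 ∷ u2 ∷ t) ∷ w2 ∷ rest) →
  ¬ (u1 + 1 < u2 × LtMin u1 w2) → ¬ (u2 ≡ u1 + 1 × LtMin u1 w2) → FFzero ((u1 ∷ u2 ∷ t) ∷ w2 ∷ rest)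
first-long-blocked {z} u1 u2 t w2 rest ((inc1 ∷ inc2 ∷ _) , red) not-far not-adjacent =
  vanishes u1 (u2 ∷ t) w2 rest inc1 inc2 not-above
    (λ w w2≡u1∷w → repeat-not-reduced u1 u2 t (w ++ concat rest) inc1
      (subst (λ v → IsFPFWord z (u1 ∷ u2 ∷ t ++ v ++ concat rest)) w2≡u1∷w red))
  where
  not-above : ¬ LtMin u1 w2
  not-above u1<w2 with m≤n⇒m<n∨m≡n (Linked.head inc1)
  ... | inj₁ 1+u1<u2 = not-far (subst (_< u2) (sym (+-comm u1 1)) 1+u1<u2 , u1<w2)
  ... | inj₂ 1+u1≡u2 = not-adjacent (trans (sym 1+u1≡u2) (+-comm 1 u1) , u1<w2)

first-long : ∀ {z} w1 w2 rest → IsRF z (w1 ∷ w2 ∷ rest) → ∀ u1 u2 t → w1 ≡ u1 ∷ u2 ∷ t →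
  (u1 + 1 < u2 → LtMin u1 w2 →
    ∃₂ λ w1′ w2′ → FF z (w1 ∷ w2 ∷ rest) (w1′ ∷ w2′ ∷ rest) ×
      (∀ x → (x ∈ w1′) ⇔ (x ∈ w1 × x ≢ u1)) × (∀ x → (x ∈ w2′) ⇔ (x ∈ w2 ⊎ x ≡ u1))) ×
  (u2 ≡ u1 + 1 → LtMin u1 w2 →
    ∃₂ λ w1′ w2′ → FF z (w1 ∷ w2 ∷ rest) (w1′ ∷ w2′ ∷ rest) ×
      (∀ x → (x ∈ w1′) ⇔ (x ∈ w1 × x ≢ u1 + 1)) × (∀ x → (x ∈ w2′) ⇔ (x ∈ w2 ⊎ x ≡ u1 ∸ 1))) ×
  (¬ (u1 + 1 < u2 × LtMin u1 w2) → ¬ (u2 ≡ u1 + 1 × LtMin u1 w2) → FFzero (w1 ∷ w2 ∷ rest))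
first-long .(u1 ∷ u2 ∷ t) w2 rest rf u1 u2 t refl =
  first-long-far u1 u2 t w2 rest rf , first-long-adjacent u1 u2 t w2 rest rf , first-long-blocked u1 u2 t w2 rest rf

lemma5p3 : (z : ℕ → ℕ) → InF∞ z →
    (w1 w2 : List ℕ) (rest : List (List ℕ)) →
    IsRF z (w1 ∷ w2 ∷ rest) →
    (w1 ≡ [] → FFzero (w1 ∷ w2 ∷ rest)) ×
    (∀ u1 → w1 ≡ [ u1 ] →
      (LtMin u1 w2 →
        ∃ λ w2' → FF z (w1 ∷ w2 ∷ rest) ([] ∷ w2' ∷ rest) ×
          (∀ x → (x ∈ w2') ⇔ (x ∈ w2 ⊎ x ≡ u1))) ×
      (¬ LtMin u1 w2 → FFzero (w1 ∷ w2 ∷ rest))) ×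
    (∀ u1 u2 t → w1 ≡ u1 ∷ u2 ∷ t →
      (u1 + 1 < u2 → LtMin u1 w2 →
        ∃₂ λ w1' w2' → FF z (w1 ∷ w2 ∷ rest) (w1' ∷ w2' ∷ rest) ×
          (∀ x → (x ∈ w1') ⇔ (x ∈ w1 × x ≢ u1)) ×
          (∀ x → (x ∈ w2') ⇔ (x ∈ w2 ⊎ x ≡ u1))) ×
      (u2 ≡ u1 + 1 → LtMin u1 w2 →
        ∃₂ λ w1' w2' → FF z (w1 ∷ w2 ∷ rest) (w1' ∷ w2' ∷ rest) ×
          (∀ x → (x ∈ w1') ⇔ (x ∈ w1 × x ≢ u1 + 1)) ×
          (∀ x → (x ∈ w2') ⇔ (x ∈ w2 ⊎ x ≡ u1 ∸ 1))) ×
      (¬ (u1 + 1 < u2 × LtMin u1 w2) → ¬ (u2 ≡ u1 + 1 × LtMin u1 w2) →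
        FFzero (w1 ∷ w2 ∷ rest)))
lemma5p3 z _ w1 w2 rest rf = first-empty w1 w2 rest , first-single w1 w2 rest rf , first-long w1 w2 rest rf
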